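{- Suppose that at the end of iteration $h$ of the procedure described in the context, $Z^{(h)}[\ell,m]$ is a monochrome block. Then (i) for every $g>h$, $Z^{(g)}[\ell,m]=Z^{(h)}[\ell,m]$; and (ii) the set of positions of $Z^{(h+1)}$ written during iteration $h+1$ while the loop index $k$ ranges over $[\ell,m]$ is a union of monochrome blocks of $Z^{(h+1)}$.
   Context: Let $\Sigma$ be an alphabet of constant size $\sigma$, extended with two special symbols $\$_0<\$_1$ smaller than every symbol of $\Sigma$. Let $t_0[1,n_0]$ and $t_1[1,n_1]$ be strings with $t_0[n_0]=\$_0$ and $t_1[n_1]=\$_1$, these symbols occurring nowhere else. For $\delta\in\{0,1\}$, $sa_\delta$ is the suffix array of $t_\delta$ and $\mathsf{bwt}_\delta[i]=t_\delta[sa_\delta[i]-1]$ if $sa_\delta[i]>1$, $\mathsf{bwt}_\delta[i]=t_\delta[n_\delta]$ if $sa_\delta[i]=1$. Let $n=n_0+n_1$. Procedure. It maintains bit vectors $Z^{(h)}[1,n]$ and an integer array $B[1,n+1]$. Initially $Z^{(0)}=0^{n_0}1^{n_1}$, $B=1\,0^{n-1}\,1$. Iteration $h\ge1$: set $k_0=k_1=1$; $\mathsf{Block\_id}[c]=-1$ for every symbol $c$ (including $\$_0,\$_1$); for $c\in\Sigma$, $F[c]=1+$ (number of occurrences in $\mathsf{bwt}_0,\mathsf{bwt}_1$ of symbols smaller than $c$, counting $\$_0,\$_1$ as smaller). For $k=1,\ldots,n$: (1) if $B[k]\neq0$ and $B[k]\neq h$, set $\mathsf{id}=k$; (2) $b=Z^{(h-1)}[k]$,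 $c=\mathsf{bwt}_b[k_b]$, increment $k_b$; (3) if $c\in\Sigma$, $j=F[c]$ and increment $F[c]$, else ($c=\$_b$) $j=b+1$; (4) $Z^{(h)}[j]=b$; (5) if $\mathsf{Block\_id}[c]\neq\mathsf{id}$, set $\mathsf{Block\_id}[c]=\mathsf{id}$ and, if $B[j]=0$, set $B[j]=h$. Blocks. At the end of iteration $h$, whenever $B[\ell]\neq0$, $B[m+1]\neq0$ and $B[\ell+1]=\cdots=B[m]=0$ ($1\le\ell\le m\le n$), the interval $Z^{(h)}[\ell,m]$ is a block; it is monochrome if it contains only $0$s or only $1$s. -}

module Defs where

open import Data.Nat using (ℕ; zero; suc; _+_; _∸_; _≤_; _<_; _<ᵇ_; _≡ᵇ_)
open import Data.Bool using (Bool; true; false; if_then_else_; _∧_; _∨_; not)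
open import Data.List using (List; []; _∷_; _++_; map; length; drop; filterᵇ; upTo)
open import Data.Fin using (Fin; toℕ)
open import Data.Maybe using (Maybe; just; nothing)
open import Data.Product using (_×_; _,_; proj₁; proj₂; ∃; ∃-syntax)
open import Relation.Binary.PropositionalEquality using (_≡_; _≢_)

-- Symbol encoding (as natural numbers, order = order of ℕ):
--   $₀ ↦ 0,  $₁ ↦ 1,  c ∈ Σ = Fin σ ↦ 2 + toℕ c.

-- 1-indexed list access (default 0 out of range; never used out of range)
get : List ℕ → ℕ → ℕ
get []       _             = 0
get (x ∷ xs) zero          = 0
get (x ∷ xs) (suc zero)    = x
get (x ∷ xs) (suc (suc i)) = get xs (suc i)

lexLt : List ℕ → List ℕ → Bool
lexLt []       []       = false
lexLt []       (_ ∷ _)  = true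
lexLt (_ ∷ _)  []       = false
lexLt (x ∷ xs) (y ∷ ys) =
  if x <ᵇ y then true else (if y <ᵇ x then false else lexLt xs ys)

insertBy : (ℕ → ℕ → Bool) → ℕ → List ℕ → List ℕ
insertBy lt x []       = x ∷ []
insertBy lt x (y ∷ ys) = if lt x y then x ∷ y ∷ ys else y ∷ insertBy lt x ys

sortBy : (ℕ → ℕ → Bool) → List ℕ → List ℕ
sortBy lt []       = []
sortBy lt (x ∷ xs) = insertBy lt x (sortBy lt xs)

upd : {A : Set} → (ℕ → A) → ℕ → A → (ℕ → A)
upd f i v x = if x ≡ᵇ i then v else f x

-- Block_id[c] = just id, or nothing for the value -1
sameId : Maybe ℕ → ℕ → Bool
sameId nothing  _ = false
sameId (just x) y = x ≡ᵇ y

record IState : Set where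
  field
    k0 k1 : ℕ
    F     : ℕ → ℕ
    blk   : ℕ → Maybe ℕ
    cur   : ℕ            -- current value of the variable id
    Znew  : ℕ → Bool     -- Z^(h) being written (false = 0, true = 1)
    Bv    : ℕ → ℕ

Global : Set
Global = (ℕ → Bool) × (ℕ → ℕ)

module Text (σ : ℕ) (w₀ w₁ : List (Fin σ)) where

  code : Fin σ → ℕ
  code c = 2 + toℕ c

  -- t₀ = w₀ $₀ ,  t₁ = w₁ $₁   (index false = 0, true = 1)
  text : Bool → List ℕ
  text false = map code w₀ ++ (0 ∷ [])
  text true  = map code w₁ ++ (1 ∷ [])

  len : Bool → ℕ
  len δ = length (text δ)

  n₀ n₁ n : ℕ
  n₀ = len false
  n₁ = len true
  n  = n₀ + n₁

  suffix : Bool → ℕ → List ℕ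
  suffix δ p = drop (p ∸ 1) (text δ)

  saList : Bool → List ℕ
  saList δ = sortBy (λ p q → lexLt (suffix δ p) (suffix δ q)) (map suc (upTo (len δ)))

  sa : Bool → ℕ → ℕ
  sa δ i = get (saList δ) i

  bwt : Bool → ℕ → ℕ
  bwt δ i = if 1 <ᵇ sa δ i then get (text δ) (sa δ i ∸ 1) else get (text δ) (len δ)

  bwtList : Bool → List ℕ
  bwtList δ = map (bwt δ) (map suc (upTo (len δ)))

  Finit : ℕ → ℕ
  Finit c = suc (length (filterᵇ (λ x → x <ᵇ c) (bwtList false ++ bwtList true)))

  -- one execution of steps (1)-(5) for loop index k in iteration h,
  -- reading Z^(h-1) = Zold; returns the written position j and the new state
  step : ℕ → (ℕ → Bool) → ℕ → IState → ℕ × IState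
  step h Zold k s =
    let open IState s
        id′   = if not (Bv k ≡ᵇ 0) ∧ not (Bv k ≡ᵇ h) then k else cur
        b     = Zold k
        c     = bwt b (if b then k1 else k0)
        k0′   = if b then k0 else suc k0
        k1′   = if b then suc k1 else k1
        isΣ   = 1 <ᵇ c
        j     = if isΣ then F c else (if b then 2 else 1)
        F′    = if isΣ then upd F c (suc (F c)) else F
        Z′    = upd Znew j b
        fresh = not (sameId (blk c) id′)
        blk′  = if fresh then upd blk c (just id′) else blk
        B′    = if fresh ∧ (Bv j ≡ᵇ 0) then upd Bv j h else Bv
    in j , record { k0 = k0′ ; k1 = k1′ ; F = F′ ; blk = blk′ ; cur = id′
                  ; Znew = Z′ ; Bv = B′ }

  initState : Global → IState
  initState g = record { k0 = 1 ; k1 = 1 ; F = Finit ; blk = λ _ → nothing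
                       ; cur = 0 ; Znew = λ _ → false ; Bv = proj₂ g }

  stateAfter : ℕ → Global → ℕ → IState
  stateAfter h g zero    = initState g
  stateAfter h g (suc k) = proj₂ (step h (proj₁ g) (suc k) (stateAfter h g k))

  runIter : ℕ → Global → Global
  runIter h g = let s = stateAfter h g n in IState.Znew s , IState.Bv s

  -- (Z^(h), B) at the end of iteration h  (h = 0: initial values)
  global : ℕ → Global
  global zero    = (λ i → n₀ <ᵇ i) , (λ i → if (i ≡ᵇ 1) ∨ (i ≡ᵇ suc n) then 1 else 0)
  global (suc h) = runIter (suc h) (global h)

  Z : ℕ → ℕ → Bool
  Z h = proj₁ (global h)

  B : ℕ → ℕ → ℕ
  B h = proj₂ (global h)

  -- position j written at loop index k during iteration h (h ≥ 1)
  written : ℕ → ℕ → ℕ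
  written h k = proj₁ (step h (Z (h ∸ 1)) k (stateAfter h (global (h ∸ 1)) (k ∸ 1)))

  IsBlock : ℕ → ℕ → ℕ → Set
  IsBlock h ℓ m = (1 ≤ ℓ) × (ℓ ≤ m) × (m ≤ n) × (B h ℓ ≢ 0) × (B h (suc m) ≢ 0)
                × (∀ i → ℓ < i → i ≤ m → B h i ≡ 0)

  Monochrome : ℕ → ℕ → ℕ → Set
  Monochrome h ℓ m = ∃[ v ] (∀ i → ℓ ≤ i → i ≤ m → Z h i ≡ v)

  WrittenIn : ℕ → ℕ → ℕ → ℕ → Set
  WrittenIn h ℓ m j = ∃[ k ] ((ℓ ≤ k) × (k ≤ m) × (written h k ≡ j))

module Submission where

-- One iteration of the procedure is a stable LF-mapping pass: the k-th
-- entry of the old vector Z^(h-1) belongs to text b = Z^(h-1)[k], reads the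
-- letter c = bwt_b[rank of k among the b-entries], and is written to
-- position  pos k = F_init[c] + (number of earlier steps that read c).
-- Every quantity of the loop therefore has a closed form in terms of
-- prefix counts, and the whole proof is counting:

open import Defs
open import Data.Nat
open import Data.Nat.Properties
open import Data.Bool using (Bool; true; false; if_then_else_; _∧_; _∨_; _xor_; not; T)
open import Data.Bool.Properties using (∧-zeroʳ; ∧-identityʳ; ∨-zeroʳ)
open import Data.List using (List; []; _∷_; _++_; map; length; filterᵇ; upTo)
open import Data.List.Properties using (map-++; upTo-∷ʳ; map-id; length-map; length-upTo)
open import Data.Fin using (Fin; toℕ)
open import Data.Fin.Properties using (toℕ<n)
open import Data.Maybe using (Maybe; just; nothing)
open import Data.Maybe.Properties using (just-injective)
open import Data.Product using (_×_; _,_; proj₁; proj₂; ∃-syntax)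
open import Data.Sum using (_⊎_; inj₁; inj₂)
open import Data.Empty using (⊥-elim)
open import Data.Unit using (tt)
open import Relation.Nullary using (yes; no)
open import Function using (_$_)
open import Relation.Binary.Definitions using (tri<; tri≈; tri>)
open import Relation.Binary.PropositionalEquality
open import Algebra.Properties.CommutativeSemigroup +-commutativeSemigroup using (interchange)

true≢false : true ≢ false
true≢false ()

≡ᵇ-true⇒≡ : ∀ {x y} → (x ≡ᵇ y) ≡ true → x ≡ y
≡ᵇ-true⇒≡ {x} {y} e = ≡ᵇ⇒≡ x y (subst T (sym e) tt)

≡ᵇ-refl : ∀ x → (x ≡ᵇ x) ≡ true
≡ᵇ-refl zero = refl
≡ᵇ-refl (suc x) = ≡ᵇ-refl x

≡ᵇ-false⇒≢ : ∀ {x y} → (x ≡ᵇ y) ≡ false → x ≢ y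
≡ᵇ-false⇒≢ {x} e refl = true≢false (trans (sym (≡ᵇ-refl x)) e)

≢⇒≡ᵇ-false : ∀ {x y} → x ≢ y → (x ≡ᵇ y) ≡ false
≢⇒≡ᵇ-false {x} {y} ne with x ≡ᵇ y in e
... | true = ⊥-elim (ne (≡ᵇ-true⇒≡ e))
... | false = refl

<ᵇ-true⇒< : ∀ {x y} → (x <ᵇ y) ≡ true → x < y
<ᵇ-true⇒< {x} {y} e = <ᵇ⇒< x y (subst T (sym e) tt)

<⇒<ᵇ-true : ∀ {x y} → x < y → (x <ᵇ y) ≡ true
<⇒<ᵇ-true {zero} {suc y} p = refl
<⇒<ᵇ-true {suc x} {suc y} (s≤s p) = <⇒<ᵇ-true p

<ᵇ-false⇒≥ : ∀ {x y} → (x <ᵇ y) ≡ false → y ≤ x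
<ᵇ-false⇒≥ e = ≮⇒≥ (λ lt → true≢false (trans (sym (<⇒<ᵇ-true lt)) e))

≥⇒<ᵇ-false : ∀ {x y} → y ≤ x → (x <ᵇ y) ≡ false
≥⇒<ᵇ-false {x} {y} p with x <ᵇ y in e
... | true = ⊥-elim (<⇒≱ (<ᵇ-true⇒< e) p)
... | false = refl

∧-true⇒ˡ : ∀ x {y} → (x ∧ y) ≡ true → x ≡ true
∧-true⇒ˡ true _ = refl

∧-true⇒ʳ : ∀ x {y} → (x ∧ y) ≡ true → y ≡ true
∧-true⇒ʳ true q = q

if-true : ∀ {A : Set} {b} {x y : A} → b ≡ true → (if b then x else y) ≡ x
if-true refl = refl

if-false : ∀ {A : Set} {b} {x y : A} → b ≡ false → (if b then x else y) ≡ y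
if-false refl = refl

suc-∸1 : ∀ i → 1 ≤ i → suc (i ∸ 1) ≡ i
suc-∸1 (suc i) _ = refl

interval-induction : (P : ℕ → Set) {a b : ℕ} → a ≤ b → P a →
  (∀ k → a ≤ k → k < b → P k → P (suc k)) → P b
interval-induction P a≤b pa step with m≤n⇒m<n∨m≡n a≤b
... | inj₂ refl = pa
interval-induction P {b = suc b} _ pa step | inj₁ (s≤s a≤b) =
  step b a≤b ≤-refl (interval-induction P a≤b pa (λ k x y → step k x (m≤n⇒m≤1+n y)))

count : (ℕ → Bool) → ℕ → ℕ
count f zero = zero
count f (suc k) = if f (suc k) then suc (count f k) else count f k

count-suc-hit : ∀ f k → f (suc k) ≡ true → count f (suc k) ≡ suc (count f k)
count-suc-hit f k e rewrite e = refl

count-suc-miss : ∀ f k → f (suc k) ≡ false → count f (suc k) ≡ count f k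
count-suc-miss f k e rewrite e = refl

count-suc≤ : ∀ f k → count f (suc k) ≤ suc (count f k)
count-suc≤ f k with f (suc k)
... | true = ≤-refl
... | false = n≤1+n _

count-≤-suc : ∀ f k → count f k ≤ count f (suc k)
count-≤-suc f k with f (suc k)
... | true = n≤1+n _
... | false = ≤-refl

count-mono : ∀ f {a b} → a ≤ b → count f a ≤ count f b
count-mono f {a} le = interval-induction (λ k → count f a ≤ count f k) le ≤-refl
  (λ k _ _ ih → ≤-trans ih (count-≤-suc f k))

count≤ : ∀ f k → count f k ≤ k
count≤ f zero = z≤n
count≤ f (suc k) with f (suc k)
... | true = s≤s (count≤ f k)
... | false = m≤n⇒m≤1+n (count≤ f k)

count-cong : ∀ f g L → (∀ i → 1 ≤ i → i ≤ L → f i ≡ g i) → count f L ≡ count g L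
count-cong f g zero h = refl
count-cong f g (suc L) h rewrite h (suc L) (s≤s z≤n) ≤-refl
  | count-cong f g L (λ i p q → h i p (m≤n⇒m≤1+n q)) = refl

count≡0⇒misses : ∀ f L → count f L ≡ 0 → ∀ i → 1 ≤ i → i ≤ L → f i ≡ false
count≡0⇒misses f zero e .zero () z≤n
count≡0⇒misses f (suc L) e i p q with f (suc L) in eq
count≡0⇒misses f (suc L) () i p q | true
... | false with m≤n⇒m<n∨m≡n q
... | inj₂ refl = eq
... | inj₁ (s≤s q') = count≡0⇒misses f L e i p q'

count-never : ∀ L → count (λ _ → false) L ≡ 0
count-never zero = refl
count-never (suc L) = count-never L

count-always : ∀ L → count (λ _ → true) L ≡ L
count-always zero = refl
count-always (suc L) = cong suc (count-always L)

bit : Bool → ℕ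
bit true = 1
bit false = 0

count-suc : ∀ f k → count f (suc k) ≡ count f k + bit (f (suc k))
count-suc f k with f (suc k)
... | true = sym (+-comm (count f k) 1)
... | false = sym (+-identityʳ (count f k))

count-hit< : ∀ f k → f (suc k) ≡ true → count f k < count f (suc k)
count-hit< f k e rewrite e = ≤-refl

count-∨ : ∀ f g L → (∀ i → f i ∧ g i ≡ false) →
  count (λ i → f i ∨ g i) L ≡ count f L + count g L
count-∨ f g zero d = refl
count-∨ f g (suc L) d with f (suc L) in ef | g (suc L) in eg | count-∨ f g L d
... | true | true | _ = ⊥-elim (true≢false (trans (sym (cong₂ _∧_ ef eg)) (d (suc L))))
... | true | false | ih = cong suc ih
... | false | true | ih = trans (cong suc ih) (sym (+-suc _ _))
... | false | false | ih = ih

count-split : ∀ (z : ℕ → Bool) (f : ℕ → Bool) L →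
  count f L ≡ count (λ i → not (z i) ∧ f i) L + count (λ i → z i ∧ f i) L
count-split z f zero = refl
count-split z f (suc L) with z (suc L) | f (suc L) | count-split z f L
... | true | true | ih = trans (cong suc ih) (sym (+-suc _ _))
... | true | false | ih = ih
... | false | true | ih = cong suc ih
... | false | false | ih = ih

count-flat : ∀ f a b → a ≤ b → (∀ i → a < i → i ≤ b → f i ≡ false) → count f b ≡ count f a
count-flat f a b le h = interval-induction (λ k → count f k ≡ count f a) le refl
  (λ k x y ih → trans (count-suc-miss f k (h (suc k) (s≤s x) y)) ih)

count-flat⇒misses : ∀ f a b → count f b ≡ count f a → ∀ i → a < i → i ≤ b → f i ≡ false
count-flat⇒misses f a b e zero () y
count-flat⇒misses f a b e (suc i) x y with f (suc i) in fi
... | false = refl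
... | true = ⊥-elim (<⇒≢ (≤-trans (s≤s (count-mono f (≤-pred x)))
                          (≤-trans (count-hit< f i fi) (count-mono f y))) (sym e))

count-crossing : ∀ f lo hi t → lo ≤ hi → count f lo ≤ t → t < count f hi →
  ∃[ k ] (lo < k × k ≤ hi × count f (k ∸ 1) ≡ t × f k ≡ true)
count-crossing f lo zero t z≤n a b = ⊥-elim (<⇒≱ b a)
count-crossing f lo (suc hi) t le a b with m≤n⇒m<n∨m≡n le
... | inj₂ refl = ⊥-elim (<⇒≱ b a)
... | inj₁ (s≤s le′) with t <? count f hi
... | yes lt = let (k , x , y , u , v) = count-crossing f lo hi t le′ a lt in k , x , m≤n⇒m≤1+n y , u , v
... | no nlt = suc hi , s≤s le′ , ≤-refl , reached , hit
  where
  reached : count f hi ≡ t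
  reached = ≤-antisym (≮⇒≥ nlt) (≤-pred (≤-trans b (count-suc≤ f hi)))
  hit : f (suc hi) ≡ true
  hit with f (suc hi)
  ... | true = refl
  ... | false = ⊥-elim (<⇒≱ b (≮⇒≥ nlt))

lastNonzero : ∀ (f : ℕ → ℕ) a j → a ≤ j → f a ≢ 0 →
  ∃[ l ] (a ≤ l × l ≤ j × f l ≢ 0 × (∀ i → l < i → i ≤ j → f i ≡ 0))
lastNonzero f a j le fa with f j ≟ 0
... | no nz = j , le , ≤-refl , nz , λ i x y → ⊥-elim (<⇒≱ x y)
... | yes z0 with m≤n⇒m<n∨m≡n le
... | inj₂ refl = ⊥-elim (fa z0)
lastNonzero f a (suc j) le fa | yes z0 | inj₁ (s≤s lt) =
  let (l , x , y , u , v) = lastNonzero f a j lt fa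
  in l , x , m≤n⇒m≤1+n y , u , below v
  where
  below : ∀ {l} → (∀ i → l < i → i ≤ j → f i ≡ 0) → ∀ i → l < i → i ≤ suc j → f i ≡ 0
  below v i p q with m≤n⇒m<n∨m≡n q
  ... | inj₁ (s≤s q') = v i p q'
  ... | inj₂ refl = z0

-- The first nonzero entry of f in (j, b], given that f b is nonzero;
-- the search scans upwards from j + 1 with u bounding the distance to b.
firstNonzero′ : ∀ (f : ℕ → ℕ) u j b → b ≤ u + j → j < b → f b ≢ 0 →
  ∃[ r ] (j < r × r ≤ b × f r ≢ 0 × (∀ i → j < i → i < r → f i ≡ 0))
firstNonzero′ f zero j b le lt fb = ⊥-elim (<⇒≱ lt le)
firstNonzero′ f (suc u) j b le lt fb with f (suc j) ≟ 0
... | no nz = suc j , ≤-refl , lt , nz , λ i x y → ⊥-elim (<⇒≱ x (≤-pred y))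
... | yes z0 with m≤n⇒m<n∨m≡n lt
... | inj₂ refl = ⊥-elim (fb z0)
... | inj₁ lt′ =
  let (r , x , y , w , v) = firstNonzero′ f u (suc j) b (subst (b ≤_) (sym (+-suc u j)) le) lt′ fb
  in r , ≤-trans (n≤1+n _) x , y , w , above v
  where
  above : ∀ {r} → (∀ i → suc j < i → i < r → f i ≡ 0) → ∀ i → j < i → i < r → f i ≡ 0
  above v i p q with m≤n⇒m<n∨m≡n p
  ... | inj₁ p' = v i p' q
  ... | inj₂ refl = z0

firstNonzero : ∀ (f : ℕ → ℕ) j b → j < b → f b ≢ 0 →
  ∃[ r ] (j < r × r ≤ b × f r ≢ 0 × (∀ i → j < i → i < r → f i ≡ 0))
firstNonzero f j b lt fb = firstNonzero′ f b j b (m≤m+n b j) lt fb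

-- countL P xs = number of entries of xs satisfying P.  It is invariant
-- under the insertion sort defining the suffix array, which is how the
-- suffix array is seen to be a permutation of 1..n_δ.
countL : (ℕ → Bool) → List ℕ → ℕ
countL P [] = 0
countL P (x ∷ xs) = if P x then suc (countL P xs) else countL P xs

countL-filter : ∀ P xs → length (filterᵇ P xs) ≡ countL P xs
countL-filter P [] = refl
countL-filter P (x ∷ xs) with P x
... | true = cong suc (countL-filter P xs)
... | false = countL-filter P xs

countL-++ : ∀ P xs ys → countL P (xs ++ ys) ≡ countL P xs + countL P ys
countL-++ P [] ys = refl
countL-++ P (x ∷ xs) ys with P x
... | true = cong suc (countL-++ P xs ys)
... | false = countL-++ P xs ys

countL-always : ∀ xs → countL (λ _ → true) xs ≡ length xs
countL-always [] = refl
countL-always (x ∷ xs) = cong suc (countL-always xs)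

countL-range : ∀ P (f : ℕ → ℕ) L → countL P (map f (map suc (upTo L))) ≡ count (λ i → P (f i)) L
countL-range P f zero = refl
countL-range P f (suc L) = begin
  countL P (map f (map suc (upTo (suc L))))
    ≡⟨ cong (λ u → countL P (map f (map suc u))) (sym (upTo-∷ʳ L)) ⟩
  countL P (map f (map suc (upTo L ++ L ∷ [])))
    ≡⟨ cong (λ u → countL P (map f u)) (map-++ suc (upTo L) (L ∷ [])) ⟩
  countL P (map f (map suc (upTo L) ++ suc L ∷ []))
    ≡⟨ cong (countL P) (map-++ f (map suc (upTo L)) (suc L ∷ [])) ⟩
  countL P (map f (map suc (upTo L)) ++ f (suc L) ∷ [])
    ≡⟨ countL-++ P (map f (map suc (upTo L))) (f (suc L) ∷ []) ⟩
  countL P (map f (map suc (upTo L))) + countL P (f (suc L) ∷ [])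
    ≡⟨ cong (_+ countL P (f (suc L) ∷ [])) (countL-range P f L) ⟩
  count (λ i → P (f i)) L + countL P (f (suc L) ∷ [])
    ≡⟨ last-entry ⟩
  count (λ i → P (f i)) (suc L) ∎
  where
  open ≡-Reasoning
  last-entry : count (λ i → P (f i)) L + countL P (f (suc L) ∷ []) ≡ count (λ i → P (f i)) (suc L)
  last-entry with P (f (suc L))
  ... | true = trans (+-suc _ 0) (cong suc (+-identityʳ _))
  ... | false = +-identityʳ _

countL-insert : ∀ lt P x ys → countL P (insertBy lt x ys) ≡ countL P (x ∷ ys)
countL-insert lt P x [] = refl
countL-insert lt P x (y ∷ ys) with lt x y
... | true = refl
... | false with P y | P x | countL-insert lt P x ys
... | true | true | ih = cong suc ih
... | true | false | ih = cong suc ih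
... | false | true | ih = ih
... | false | false | ih = ih

countL-sort : ∀ lt P xs → countL P (sortBy lt xs) ≡ countL P xs
countL-sort lt P [] = refl
countL-sort lt P (x ∷ xs) = trans (countL-insert lt P x (sortBy lt xs)) (head-case (P x))
  where
  head-case : ∀ b → (if b then suc (countL P (sortBy lt xs)) else countL P (sortBy lt xs))
                  ≡ (if b then suc (countL P xs) else countL P xs)
  head-case true = cong suc (countL-sort lt P xs)
  head-case false = countL-sort lt P xs

count-shift : ∀ f L → count f (suc L) ≡ count (λ i → f (suc i)) L + (if f 1 then 1 else 0)
count-shift f zero with f 1
... | true = refl
... | false = refl
count-shift f (suc L) with f (suc (suc L)) | count-shift f L
... | true | ih = cong suc ih
... | false | ih = ih

count-get : ∀ P xs → count (λ i → P (get xs i)) (length xs) ≡ countL P xs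
count-get P [] = refl
count-get P (x ∷ xs) = trans (count-shift (λ i → P (get (x ∷ xs) i)) (length xs))
  (trans (cong (_+ (if P x then 1 else 0))
    (trans (count-cong _ _ (length xs) tail-entries) (count-get P xs))) (head-case (P x)))
  where
  tail-entries : ∀ i → 1 ≤ i → i ≤ length xs → P (get (x ∷ xs) (suc i)) ≡ P (get xs i)
  tail-entries (suc i) _ _ = refl
  head-case : ∀ b → countL P xs + (if b then 1 else 0) ≡ (if b then suc (countL P xs) else countL P xs)
  head-case true = trans (+-suc _ 0) (cong suc (+-identityʳ _))
  head-case false = +-identityʳ _

count-≡ᵇ1 : ∀ L → count (λ i → i ≡ᵇ 1) (suc L) ≡ 1
count-≡ᵇ1 zero = refl
count-≡ᵇ1 (suc L) = count-≡ᵇ1 L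

letter : ∀ {σ} → Fin σ → ℕ
letter c = 2 + toℕ c

get-letter : ∀ {σ} (w : List (Fin σ)) d p → 1 ≤ p → p ≤ length w → 2 ≤ get (map letter w ++ d ∷ []) p
get-letter (c ∷ w) d (suc zero) _ _ = s≤s (s≤s z≤n)
get-letter (c ∷ w) d (suc (suc p)) _ (s≤s q) = get-letter w d (suc p) (s≤s z≤n) q

get-terminator : ∀ {σ} (w : List (Fin σ)) d → get (map letter w ++ d ∷ []) (suc (length w)) ≡ d
get-terminator [] d = refl
get-terminator (c ∷ w) d = get-terminator w d

get-bounded : ∀ {σ} (w : List (Fin σ)) d p → d < 2 + σ → get (map letter w ++ d ∷ []) p < 2 + σ
get-bounded [] d zero q = s≤s z≤n
get-bounded [] d (suc zero) q = q
get-bounded [] d (suc (suc p)) q = s≤s z≤n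
get-bounded (c ∷ w) d zero q = s≤s z≤n
get-bounded (c ∷ w) d (suc zero) q = s≤s (s≤s (toℕ<n c))
get-bounded (c ∷ w) d (suc (suc p)) q = get-bounded w d (suc p) q

length-terminated : ∀ {σ} (w : List (Fin σ)) d → length (map letter w ++ d ∷ []) ≡ suc (length w)
length-terminated [] d = refl
length-terminated (c ∷ w) d = cong suc (length-terminated w d)

<ᵇ-suc : ∀ x c → (x <ᵇ suc c) ≡ ((x <ᵇ c) ∨ (x ≡ᵇ c))
<ᵇ-suc zero zero = refl
<ᵇ-suc zero (suc c) = refl
<ᵇ-suc (suc x) zero = refl
<ᵇ-suc (suc x) (suc c) = <ᵇ-suc x c

<ᵇ-≡ᵇ-disjoint : ∀ x c → ((x <ᵇ c) ∧ (x ≡ᵇ c)) ≡ false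
<ᵇ-≡ᵇ-disjoint zero zero = refl
<ᵇ-≡ᵇ-disjoint zero (suc c) = refl
<ᵇ-≡ᵇ-disjoint (suc x) zero = refl
<ᵇ-≡ᵇ-disjoint (suc x) (suc c) = <ᵇ-≡ᵇ-disjoint x c

sentinel : Bool → ℕ
sentinel false = 0
sentinel true = 1

module TextFacts (σ : ℕ) (w₀ w₁ : List (Fin σ)) where
  open Text σ w₀ w₁

  word : Bool → List (Fin σ)
  word false = w₀
  word true = w₁

  text≡ : ∀ δ → text δ ≡ map letter (word δ) ++ sentinel δ ∷ []
  text≡ false = refl
  text≡ true = refl

  len≡ : ∀ δ → len δ ≡ suc (length (word δ))
  len≡ δ = trans (cong length (text≡ δ)) (length-terminated (word δ) (sentinel δ))

  suffixLt : Bool → ℕ → ℕ → Bool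
  suffixLt δ p q = lexLt (suffix δ p) (suffix δ q)

  length-saList : ∀ δ → length (saList δ) ≡ len δ
  length-saList δ = trans (sym (countL-always (saList δ)))
    (trans (countL-sort (suffixLt δ) (λ _ → true) (map suc (upTo (len δ))))
    (trans (countL-always (map suc (upTo (len δ))))
    (trans (length-map suc (upTo (len δ))) (length-upTo (len δ)))))

  countL-saList : ∀ δ P → countL P (saList δ) ≡ count P (len δ)
  countL-saList δ P = trans (countL-sort (suffixLt δ) P (map suc (upTo (len δ))))
    (trans (cong (countL P) (sym (map-id (map suc (upTo (len δ)))))) (countL-range P (λ x → x) (len δ)))

  count-sa : ∀ δ P → count (λ i → P (sa δ i)) (len δ) ≡ count P (len δ)
  count-sa δ P = trans (subst (λ L → count (λ i → P (sa δ i)) L ≡ countL P (saList δ)) (length-saList δ)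
                       (count-get P (saList δ))) (countL-saList δ P)

  sa-range : ∀ δ i → 1 ≤ i → i ≤ len δ → 1 ≤ sa δ i × sa δ i ≤ len δ
  sa-range δ i p q = in-range (sa δ i) (count≡0⇒misses (λ j → bad (sa δ j)) L (trans (count-sa δ bad) no-bad) i p q)
    where
    L : ℕ
    L = len δ
    bad : ℕ → Bool
    bad y = (y ≡ᵇ 0) ∨ (L <ᵇ y)
    no-bad : count bad L ≡ 0
    no-bad = trans (count-cong bad (λ _ → false) L good) (count-never L)
      where
      good : ∀ j → 1 ≤ j → j ≤ L → bad j ≡ false
      good (suc j) _ q' = ≥⇒<ᵇ-false q'
    in-range : ∀ s → bad s ≡ false → 1 ≤ s × s ≤ L
    in-range (suc s) e = s≤s z≤n , <ᵇ-false⇒≥ e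

  count-sa-first : ∀ δ → count (λ i → sa δ i ≡ᵇ 1) (len δ) ≡ 1
  count-sa-first δ = trans (count-sa δ (λ y → y ≡ᵇ 1))
    (subst (λ L → count (λ i → i ≡ᵇ 1) L ≡ 1) (sym (len≡ δ)) (count-≡ᵇ1 (length (word δ))))

  text-letter : ∀ δ p → 1 ≤ p → p ≤ length (word δ) → 2 ≤ get (text δ) p
  text-letter δ p a b = subst (λ t → 2 ≤ get t p) (sym (text≡ δ)) (get-letter (word δ) (sentinel δ) p a b)

  text-last : ∀ δ → get (text δ) (len δ) ≡ sentinel δ
  text-last δ = trans (cong (get (text δ)) (len≡ δ))
    (subst (λ t → get t (suc (length (word δ))) ≡ sentinel δ) (sym (text≡ δ)) (get-terminator (word δ) (sentinel δ)))

  sentinel<2 : ∀ δ → sentinel δ < 2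
  sentinel<2 false = s≤s z≤n
  sentinel<2 true = s≤s (s≤s z≤n)

  sentinel-distinct : ∀ δ → sentinel δ ≢ sentinel (not δ)
  sentinel-distinct false ()
  sentinel-distinct true ()

  text-bounded : ∀ δ p → get (text δ) p < 2 + σ
  text-bounded δ p = subst (λ t → get t p < 2 + σ) (sym (text≡ δ))
    (get-bounded (word δ) (sentinel δ) p (≤-trans (sentinel<2 δ) (s≤s (s≤s z≤n))))

  bwtOf : Bool → ℕ → ℕ
  bwtOf δ s = if 1 <ᵇ s then get (text δ) (s ∸ 1) else get (text δ) (len δ)

  bwtOf-cases : ∀ δ s → 1 ≤ s → s ≤ len δ → (2 ≤ bwtOf δ s × s ≢ 1) ⊎ (bwtOf δ s ≡ sentinel δ × s ≡ 1)
  bwtOf-cases δ (suc zero) _ _ = inj₂ (text-last δ , refl)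
  bwtOf-cases δ (suc (suc s)) _ q =
    inj₁ (text-letter δ (suc s) (s≤s z≤n) (≤-pred (subst (suc (suc s) ≤_) (len≡ δ) q)) , λ ())

  bwt-cases : ∀ δ i → 1 ≤ i → i ≤ len δ → (2 ≤ bwt δ i × sa δ i ≢ 1) ⊎ (bwt δ i ≡ sentinel δ × sa δ i ≡ 1)
  bwt-cases δ i p q = bwtOf-cases δ (sa δ i) (proj₁ (sa-range δ i p q)) (proj₂ (sa-range δ i p q))

  bwt-bounded : ∀ δ i → bwt δ i < 2 + σ
  bwt-bounded δ i with 1 <ᵇ sa δ i
  ... | true = text-bounded δ _
  ... | false = text-bounded δ _

  bwt-small : ∀ δ i → 1 ≤ i → i ≤ len δ → bwt δ i < 2 → bwt δ i ≡ sentinel δ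
  bwt-small δ i p q lt with bwt-cases δ i p q
  ... | inj₁ (a , _) = ⊥-elim (<⇒≱ lt a)
  ... | inj₂ (a , _) = a

  occ : Bool → ℕ → ℕ → ℕ
  occ δ c r = count (λ i → bwt δ i ≡ᵇ c) r

  occLess : Bool → ℕ → ℕ → ℕ
  occLess δ c r = count (λ i → bwt δ i <ᵇ c) r

  occ-own-sentinel : ∀ δ → occ δ (sentinel δ) (len δ) ≡ 1
  occ-own-sentinel δ = trans (count-cong _ _ (len δ) same-hits) (count-sa-first δ)
    where
    same-hits : ∀ i → 1 ≤ i → i ≤ len δ → (bwt δ i ≡ᵇ sentinel δ) ≡ (sa δ i ≡ᵇ 1)
    same-hits i p q with bwt-cases δ i p q
    ... | inj₁ (a , b) = trans (≢⇒≡ᵇ-false (λ e → <⇒≱ (sentinel<2 δ) (subst (2 ≤_) e a))) (sym (≢⇒≡ᵇ-false b))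
    ... | inj₂ (a , b) rewrite a | b = ≡ᵇ-refl (sentinel δ)

  occ-other-sentinel : ∀ δ → occ δ (sentinel (not δ)) (len δ) ≡ 0
  occ-other-sentinel δ = trans (count-cong _ _ (len δ) no-hit) (count-never (len δ))
    where
    no-hit : ∀ i → 1 ≤ i → i ≤ len δ → (bwt δ i ≡ᵇ sentinel (not δ)) ≡ false
    no-hit i p q with bwt-cases δ i p q
    ... | inj₁ (a , b) = ≢⇒≡ᵇ-false (λ e → <⇒≱ (sentinel<2 (not δ)) (subst (2 ≤_) e a))
    ... | inj₂ (a , b) = ≢⇒≡ᵇ-false (λ e → sentinel-distinct δ (trans (sym a) e))

  occLess-suc : ∀ δ c r → occLess δ (suc c) r ≡ occLess δ c r + occ δ c r
  occLess-suc δ c r = trans (count-cong _ _ r (λ i _ _ → <ᵇ-suc (bwt δ i) c))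
    (count-∨ (λ i → bwt δ i <ᵇ c) (λ i → bwt δ i ≡ᵇ c) r (λ i → <ᵇ-≡ᵇ-disjoint (bwt δ i) c))

  occLess-zero : ∀ δ r → occLess δ 0 r ≡ 0
  occLess-zero δ r = count-never r

  occLess-top : ∀ δ r → occLess δ (2 + σ) r ≡ r
  occLess-top δ r = trans (count-cong _ _ r (λ i _ _ → <⇒<ᵇ-true (bwt-bounded δ i))) (count-always r)

  Finit≡ : ∀ c → Finit c ≡ suc (occLess false c n₀ + occLess true c n₁)
  Finit≡ c = cong suc (trans (countL-filter _ (bwtList false ++ bwtList true))
    (trans (countL-++ _ (bwtList false) (bwtList true))
      (cong₂ _+_ (countL-range (λ x → x <ᵇ c) (bwt false) (len false))
                 (countL-range (λ x → x <ᵇ c) (bwt true) (len true)))))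

-- One iteration p of the procedure, reading z = Z^(p-1) and starting from
-- the marks B0 = B at the end of iteration p - 1.  Every loop variable
-- after k steps is given in closed form.
module Pass (σ : ℕ) (w₀ w₁ : List (Fin σ)) (p : ℕ) (z : ℕ → Bool) (B0 : ℕ → ℕ) where
  open Text σ w₀ w₁
  open TextFacts σ w₀ w₁

  state : ℕ → IState
  state k = stateAfter p (z , B0) k

  zeros ones : ℕ → ℕ
  zeros = count (λ i → not (z i))
  ones = count z

  zeros+ones : ∀ k → zeros k + ones k ≡ k
  zeros+ones zero = refl
  zeros+ones (suc k) with z (suc k)
  ... | true = trans (+-suc _ _) (cong suc (zeros+ones k))
  ... | false = cong suc (zeros+ones k)

  rank : ℕ → ℕ
  rank k = if z k then ones k else zeros k

  letterRead : ℕ → ℕ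
  letterRead k = bwt (z k) (rank k)

  seen : ℕ → ℕ → ℕ
  seen c = count (λ i → letterRead i ≡ᵇ c)

  seen-suc-hit : ∀ c k → letterRead (suc k) ≡ c → seen c (suc k) ≡ suc (seen c k)
  seen-suc-hit c k e = count-suc-hit (λ i → letterRead i ≡ᵇ c) k (subst (λ x → (x ≡ᵇ c) ≡ true) (sym e) (≡ᵇ-refl c))

  seen-suc-miss : ∀ c k → letterRead (suc k) ≢ c → seen c (suc k) ≡ seen c k
  seen-suc-miss c k ne = count-suc-miss (λ i → letterRead i ≡ᵇ c) k (≢⇒≡ᵇ-false ne)

  dest : ℕ → ℕ
  dest k = if 1 <ᵇ letterRead k then Finit (letterRead k) + seen (letterRead k) (k ∸ 1) else (if z k then 2 else 1)

  -- A mark of B0 that was not set during this iteration; such positions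
  -- start a new value of the variable id, which is blockId k after k steps.
  oldMark : ℕ → Bool
  oldMark k = not (B0 k ≡ᵇ 0) ∧ not (B0 k ≡ᵇ p)

  blockId : ℕ → ℕ
  blockId zero = zero
  blockId (suc k) = if oldMark (suc k) then suc k else blockId k

  readc : ℕ → ℕ
  readc k = bwt (z (suc k)) (if z (suc k) then IState.k1 (state k) else IState.k0 (state k))

  idAt : ℕ → ℕ
  idAt k = if not (IState.Bv (state k) (suc k) ≡ᵇ 0) ∧ not (IState.Bv (state k) (suc k) ≡ᵇ p)
           then suc k else IState.cur (state k)

  jAt : ℕ → ℕ
  jAt k = if 1 <ᵇ readc k then IState.F (state k) (readc k) else (if z (suc k) then 2 else 1)

  freshAt : ℕ → Bool
  freshAt k = not (sameId (IState.blk (state k) (readc k)) (idAt k))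

  Fupdate : (ℕ → ℕ) → ℕ → (ℕ → ℕ)
  Fupdate F c = if 1 <ᵇ c then upd F c (suc (F c)) else F

  Bupdate : (ℕ → ℕ) → Bool → ℕ → (ℕ → ℕ)
  Bupdate Bv fr j = if fr ∧ (Bv j ≡ᵇ 0) then upd Bv j p else Bv

  k0≡ : ∀ k → IState.k0 (state k) ≡ suc (zeros k)
  k0≡ zero = refl
  k0≡ (suc k) with z (suc k)
  ... | true = k0≡ k
  ... | false = cong suc (k0≡ k)

  k1≡ : ∀ k → IState.k1 (state k) ≡ suc (ones k)
  k1≡ zero = refl
  k1≡ (suc k) with z (suc k)
  ... | true = cong suc (k1≡ k)
  ... | false = k1≡ k

  readc≡ : ∀ k → readc k ≡ letterRead (suc k)
  readc≡ k with z (suc k)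
  ... | true = cong (bwt true) (k1≡ k)
  ... | false = cong (bwt false) (k0≡ k)

  F≡ : ∀ k c → (1 <ᵇ c) ≡ true → IState.F (state k) c ≡ Finit c + seen c k
  F≡ zero c e = sym (+-identityʳ _)
  F≡ (suc k) c′ e′ = trans (cong (λ x → Fupdate (IState.F (state k)) x c′) (readc≡ k)) (updated _ refl c′ e′)
    where
    updated : ∀ c → letterRead (suc k) ≡ c → ∀ c′ → (1 <ᵇ c′) ≡ true →
      Fupdate (IState.F (state k)) c c′ ≡ Finit c′ + seen c′ (suc k)
    updated c rc c′ e′ with 1 <ᵇ c in e1 | c′ ≡ᵇ c in e2
    ... | true | true rewrite ≡ᵇ-true⇒≡ {c′} {c} e2 | ≡ᵇ-refl c =
      trans (cong suc (F≡ k c e1)) (trans (sym (+-suc (Finit c) (seen c k))) (cong (Finit c +_) (sym (seen-suc-hit c k rc))))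
    ... | true | false rewrite e2 =
      trans (F≡ k c′ e′) (cong (Finit c′ +_) (sym (seen-suc-miss c′ k (λ x → ≡ᵇ-false⇒≢ e2 (trans (sym x) rc)))))
    ... | false | _ = trans (F≡ k c′ e′) (cong (Finit c′ +_) (sym (seen-suc-miss c′ k ne)))
      where
      ne : letterRead (suc k) ≢ c′
      ne x = true≢false (trans (sym e′) (trans (cong (1 <ᵇ_) (trans (sym x) rc)) e1))

  Bpartial : ℕ → ℕ → ℕ
  Bpartial K = IState.Bv (state K)

  BInv : (ℕ → ℕ) → Set
  BInv Bv = ∀ i → Bv i ≡ B0 i ⊎ (B0 i ≡ 0 × Bv i ≡ p)

  BInv-step : ∀ Bv fr j → BInv Bv → BInv (Bupdate Bv fr j)
  BInv-step Bv fr j inv i with fr ∧ (Bv j ≡ᵇ 0) in e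
  ... | false = inv i
  ... | true with i ≡ᵇ j in e2
  ... | false = inv i
  ... | true = set-here (≡ᵇ-true⇒≡ {i} {j} e2)
    where
    set-here : i ≡ j → p ≡ B0 i ⊎ (B0 i ≡ 0 × p ≡ p)
    set-here refl with inv i
    ... | inj₂ (a , _) = inj₂ (a , refl)
    ... | inj₁ a = inj₂ (trans (sym a) (≡ᵇ-true⇒≡ (∧-true⇒ʳ fr e)) , refl)

  B-inv : ∀ k → BInv (Bpartial k)
  B-inv zero i = inj₁ refl
  B-inv (suc k) = BInv-step (Bpartial k) (freshAt k) (jAt k) (B-inv k)

  mark-value : ∀ K i → Bpartial K i ≡ B0 i ⊎ Bpartial K i ≡ p
  mark-value K i with B-inv K i
  ... | inj₁ a = inj₁ a
  ... | inj₂ (_ , b) = inj₂ b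

  isOldMark : ℕ → Bool
  isOldMark x = not (x ≡ᵇ 0) ∧ not (x ≡ᵇ p)

  isOldMark≡ : ∀ k → isOldMark (Bpartial k (suc k)) ≡ oldMark (suc k)
  isOldMark≡ k with B-inv k (suc k)
  ... | inj₁ a = cong isOldMark a
  ... | inj₂ (a , b) rewrite a | b | ≡ᵇ-refl p = ∧-zeroʳ _

  blockId≡ : ∀ k → IState.cur (state k) ≡ blockId k
  blockId≡ zero = refl
  blockId≡ (suc k) = trans (cong (λ x → if x then suc k else IState.cur (state k)) (isOldMark≡ k))
    (cong (λ y → if oldMark (suc k) then suc k else y) (blockId≡ k))

  blockId≤ : ∀ k → blockId k ≤ k
  blockId≤ zero = z≤n
  blockId≤ (suc k) with oldMark (suc k)
  ... | true = ≤-refl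
  ... | false = m≤n⇒m≤1+n (blockId≤ k)

  blockId-≤-suc : ∀ k → blockId k ≤ blockId (suc k)
  blockId-≤-suc k with oldMark (suc k)
  ... | true = m≤n⇒m≤1+n (blockId≤ k)
  ... | false = ≤-refl

  blockId-mono : ∀ {a b} → a ≤ b → blockId a ≤ blockId b
  blockId-mono {a} le = interval-induction (λ k → blockId a ≤ blockId k) le ≤-refl
    (λ k _ _ ih → ≤-trans ih (blockId-≤-suc k))

  blockId≥ : ∀ q k → oldMark q ≡ true → 1 ≤ q → q ≤ k → q ≤ blockId k
  blockId≥ (suc q) k e _ le = ≤-trans (≤-reflexive (sym (if-true e))) (blockId-mono le)

  blockId-flat : ∀ a b → a ≤ b → (∀ q → a < q → q ≤ b → oldMark q ≡ false) → blockId b ≡ blockId a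
  blockId-flat a b le h = interval-induction (λ k → blockId k ≡ blockId a) le refl
    (λ k x y ih → trans (if-false (h (suc k) (s≤s x) y)) ih)

  blockId-oldMark : ∀ k → 1 ≤ blockId k → oldMark (blockId k) ≡ true
  blockId-oldMark (suc k) h with oldMark (suc k) in e
  ... | true = e
  ... | false = blockId-oldMark k h

  oldMark⇒mark : ∀ x → oldMark x ≡ true → B0 x ≢ 0
  oldMark⇒mark x e z0 rewrite z0 = true≢false (sym e)

  -- The table Block_id after k steps records, for each letter c read so
  -- far, the block id of the last step that read c.
  idTable : ℕ → ℕ → Maybe ℕ
  idTable k = IState.blk (state k)

  isFresh : ℕ → Bool
  isFresh k = not (sameId (idTable k (letterRead (suc k))) (blockId (suc k)))

  freshAt≡ : ∀ k → freshAt k ≡ isFresh k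
  freshAt≡ k = cong₂ (λ c x → not (sameId (idTable k c) x)) (readc≡ k) (blockId≡ (suc k))

  recorded : ℕ → ℕ → Maybe ℕ
  recorded k = upd (idTable k) (letterRead (suc k)) (just (blockId (suc k)))

  idTable-step : ∀ k → idTable (suc k) ≡ (if isFresh k then recorded k else idTable k)
  idTable-step k = cong₂ (λ b u → if b then u else idTable k) (freshAt≡ k)
                     (cong₂ (λ c x → upd (idTable k) c (just x)) (readc≡ k) (blockId≡ (suc k)))

  idTable-fresh : ∀ k → isFresh k ≡ true → idTable (suc k) ≡ recorded k
  idTable-fresh k e = trans (idTable-step k) (if-true e)

  idTable-stale : ∀ k → isFresh k ≡ false → idTable (suc k) ≡ idTable k
  idTable-stale k e = trans (idTable-step k) (if-false e)

  stale-recorded : ∀ k → isFresh k ≡ false → idTable k (letterRead (suc k)) ≡ just (blockId (suc k))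
  stale-recorded k e = same (idTable k (letterRead (suc k))) e
    where
    not-false : ∀ {b} → not b ≡ false → b ≡ true
    not-false {true} _ = refl
    same : ∀ m → not (sameId m (blockId (suc k))) ≡ false → m ≡ just (blockId (suc k))
    same nothing ()
    same (just x) e = cong just (≡ᵇ-true⇒≡ (not-false e))

  IdTableInv : ℕ → ℕ → Set
  IdTableInv k c = (idTable k c ≡ nothing → ∀ k' → 1 ≤ k' → k' ≤ k → letterRead k' ≢ c)
    × (∀ x → idTable k c ≡ just x → ∃[ k' ] (1 ≤ k' × k' ≤ k × letterRead k' ≡ c × blockId k' ≡ x
                                          × (∀ k'' → k' < k'' → k'' ≤ k → letterRead k'' ≢ c)))

  IdTableInv-other : ∀ k c → letterRead (suc k) ≢ c → IdTableInv k c → idTable (suc k) c ≡ idTable k c →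
    IdTableInv (suc k) c
  IdTableInv-other k c ne (none , last) eq =
      (λ e k' a b s → split k' b (λ b' → none (trans (sym eq) e) k' a b' s) (λ e' → ne (trans (cong letterRead (sym e')) s)))
    , λ x e → let (k' , a , b , s , cu , nl) = last x (trans (sym eq) e)
              in k' , a , m≤n⇒m≤1+n b , s , cu ,
                 λ k'' l1 l2 s → split k'' l2 (λ l2' → nl k'' l1 l2' s) (λ e' → ne (trans (cong letterRead (sym e')) s))
    where
    split : ∀ {A : Set} k' → k' ≤ suc k → (k' ≤ k → A) → (k' ≡ suc k → A) → A
    split k' b f g with m≤n⇒m<n∨m≡n b
    ... | inj₁ (s≤s b') = f b'
    ... | inj₂ e = g e

  IdTableInv-this : ∀ k → idTable (suc k) (letterRead (suc k)) ≡ just (blockId (suc k)) →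
    IdTableInv (suc k) (letterRead (suc k))
  IdTableInv-this k eq =
      (λ e → ⊥-elim (just≢nothing (trans (sym eq) e)))
    , λ x e → suc k , s≤s z≤n , ≤-refl , refl , just-injective (trans (sym eq) e) , λ k'' l1 l2 → ⊥-elim (<⇒≱ l1 l2)
    where
    just≢nothing : ∀ {x : ℕ} → just x ≢ nothing
    just≢nothing ()

  idTable-inv : ∀ k c → IdTableInv k c
  idTable-inv zero c = (λ _ k' a b → ⊥-elim (<⇒≱ a b)) , (λ x ())
  idTable-inv (suc k) c with isFresh k in ef | c ≡ᵇ letterRead (suc k) in ec
  ... | true | true = subst (IdTableInv (suc k)) (sym (≡ᵇ-true⇒≡ ec)) $
    IdTableInv-this k (trans (cong (λ t → t (letterRead (suc k))) (idTable-fresh k ef)) (if-true (≡ᵇ-refl (letterRead (suc k)))))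
  ... | true | false = IdTableInv-other k c (λ x → ≡ᵇ-false⇒≢ ec (sym x)) (idTable-inv k c)
    (trans (cong (λ t → t c) (idTable-fresh k ef)) (if-false ec))
  ... | false | false = IdTableInv-other k c (λ x → ≡ᵇ-false⇒≢ ec (sym x)) (idTable-inv k c)
    (cong (λ t → t c) (idTable-stale k ef))
  ... | false | true = subst (IdTableInv (suc k)) (sym (≡ᵇ-true⇒≡ ec)) $
    IdTableInv-this k (trans (cong (λ t → t (letterRead (suc k))) (idTable-stale k ef)) (stale-recorded k ef))

  fresh⇒new : ∀ k → isFresh k ≡ true → ∀ k'' → 1 ≤ k'' → k'' ≤ k →
    letterRead k'' ≡ letterRead (suc k) → blockId k'' ≢ blockId (suc k)
  fresh⇒new k ef k'' a b s ce with idTable k (letterRead (suc k)) in eb | idTable-inv k (letterRead (suc k))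
  ... | nothing | (none , _) = none refl k'' a b s
  ... | just x | (_ , last) with last x refl
  ... | (k' , a' , b' , s' , cu , nl) = true≢false (trans (sym ef) (cong not same))
    where
    k''≤k' : k'' ≤ k'
    k''≤k' = ≮⇒≥ (λ l → nl k'' l b s)
    x≡ : x ≡ blockId (suc k)
    x≡ = trans (sym cu) (≤-antisym (blockId-mono (m≤n⇒m≤1+n b')) (subst (_≤ blockId k') ce (blockId-mono k''≤k')))
    same : sameId (just x) (blockId (suc k)) ≡ true
    same = subst (λ y → (y ≡ᵇ blockId (suc k)) ≡ true) (sym x≡) (≡ᵇ-refl (blockId (suc k)))

  new⇒fresh : ∀ k → (∀ k'' → 1 ≤ k'' → k'' ≤ k → letterRead k'' ≡ letterRead (suc k) → blockId k'' ≢ blockId (suc k)) →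
    isFresh k ≡ true
  new⇒fresh k h with idTable k (letterRead (suc k)) in eb | idTable-inv k (letterRead (suc k))
  ... | nothing | _ = refl
  ... | just x | (_ , last) with x ≡ᵇ blockId (suc k) in ex
  ... | false = refl
  ... | true with last x refl
  ... | (k' , a' , b' , s' , cu , nl) = ⊥-elim (h k' a' b' s' (trans cu (≡ᵇ-true⇒≡ ex)))

  Bupdate-keeps : ∀ Bv fr j i → Bv i ≢ 0 → Bupdate Bv fr j i ≢ 0
  Bupdate-keeps Bv fr j i ne with fr ∧ (Bv j ≡ᵇ 0) in e
  ... | false = ne
  ... | true with i ≡ᵇ j in e2
  ... | false = ne
  ... | true = λ _ → ne (trans (cong Bv (≡ᵇ-true⇒≡ e2)) (≡ᵇ-true⇒≡ (∧-true⇒ʳ fr e)))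

  Bupdate-sets : ∀ Bv j → p ≢ 0 → Bupdate Bv true j j ≢ 0
  Bupdate-sets Bv j pn with Bv j ≡ᵇ 0 in e
  ... | false = ≡ᵇ-false⇒≢ e
  ... | true rewrite ≡ᵇ-refl j = pn

  Bupdate-origin : ∀ Bv fr j i → Bupdate Bv fr j i ≢ 0 → Bv i ≢ 0 ⊎ (fr ≡ true × j ≡ i)
  Bupdate-origin Bv fr j i ne with fr ∧ (Bv j ≡ᵇ 0) in e
  ... | false = inj₁ ne
  ... | true with i ≡ᵇ j in e2
  ... | false = inj₁ ne
  ... | true = inj₂ (∧-true⇒ˡ fr e , sym (≡ᵇ-true⇒≡ e2))

  mark-keep : ∀ K K' i → K ≤ K' → Bpartial K i ≢ 0 → Bpartial K' i ≢ 0
  mark-keep K K' i le ne = interval-induction (λ k → Bpartial k i ≢ 0) le ne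
    (λ k _ _ ih → Bupdate-keeps (Bpartial k) (freshAt k) (jAt k) i ih)

  mark-old : ∀ K i → B0 i ≢ 0 → Bpartial K i ≢ 0
  mark-old K i ne with B-inv K i
  ... | inj₁ a = λ x → ne (trans (sym a) x)
  ... | inj₂ (a , _) = ⊥-elim (ne a)

  mark-fresh : ∀ k K → k < K → p ≢ 0 → freshAt k ≡ true → Bpartial K (jAt k) ≢ 0
  mark-fresh k K lt pn ef = mark-keep (suc k) K (jAt k) lt
    (subst (λ b → Bupdate (Bpartial k) b (jAt k) (jAt k) ≢ 0) (sym ef) (Bupdate-sets (Bpartial k) (jAt k) pn))

  mark-origin : ∀ K i → Bpartial K i ≢ 0 → B0 i ≢ 0 ⊎ ∃[ k ] (k < K × freshAt k ≡ true × jAt k ≡ i)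
  mark-origin zero i ne = inj₁ ne
  mark-origin (suc K) i ne with Bupdate-origin (Bpartial K) (freshAt K) (jAt K) i ne
  ... | inj₂ (a , b) = inj₂ (K , ≤-refl , a , b)
  ... | inj₁ ne' with mark-origin K i ne'
  ... | inj₁ x = inj₁ x
  ... | inj₂ (k , l , a , b) = inj₂ (k , m≤n⇒m≤1+n l , a , b)

  -- The reads of the entries of text δ are bwt_δ[1], bwt_δ[2], … in order,
  -- so seen c q counts occurrences of c in the BWT prefixes already read.
  reads-zeros : ∀ (P : ℕ → Bool) q → count (λ i → not (z i) ∧ P (letterRead i)) q ≡ count (λ i → P (bwt false i)) (zeros q)
  reads-zeros P zero = refl
  reads-zeros P (suc q) with z (suc q)
  ... | true = reads-zeros P q
  ... | false with P (bwt false (suc (zeros q)))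
  ... | true = cong suc (reads-zeros P q)
  ... | false = reads-zeros P q

  reads-ones : ∀ (P : ℕ → Bool) q → count (λ i → z i ∧ P (letterRead i)) q ≡ count (λ i → P (bwt true i)) (ones q)
  reads-ones P zero = refl
  reads-ones P (suc q) with z (suc q)
  ... | false = reads-ones P q
  ... | true with P (bwt true (suc (ones q)))
  ... | true = cong suc (reads-ones P q)
  ... | false = reads-ones P q

  seen≡ : ∀ c q → seen c q ≡ occ false c (zeros q) + occ true c (ones q)
  seen≡ c q = trans (count-split z (λ i → letterRead i ≡ᵇ c) q)
    (cong₂ _+_ (reads-zeros (λ x → x ≡ᵇ c) q) (reads-ones (λ x → x ≡ᵇ c) q))

  occ-zeros-suc : ∀ c q → occ false c (zeros (suc q)) ≡ occ false c (zeros q) + bit (not (z (suc q)) ∧ (letterRead (suc q) ≡ᵇ c))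
  occ-zeros-suc c q with z (suc q)
  ... | true = sym (+-identityʳ _)
  ... | false = count-suc (λ i → bwt false i ≡ᵇ c) (zeros q)

  Finit≥1 : ∀ c → 1 ≤ Finit c
  Finit≥1 c = s≤s z≤n

  Finit≤ : ∀ c → Finit c ≤ suc n
  Finit≤ c = subst (_≤ suc n) (sym (Finit≡ c)) (s≤s (+-mono-≤ (count≤ _ n₀) (count≤ _ n₁)))

  Finit0 : Finit 0 ≡ 1
  Finit0 = trans (Finit≡ 0) (cong suc (cong₂ _+_ (occLess-zero false n₀) (occLess-zero true n₁)))

  FinitTop : Finit (2 + σ) ≡ suc n
  FinitTop = trans (Finit≡ (2 + σ)) (cong suc (cong₂ _+_ (occLess-top false n₀) (occLess-top true n₁)))

  -- The rest of the analysis assumes that z is a valid interleaving of the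
  -- two BWTs: it contains n₀ zeros (and hence n₁ ones).
  module Balanced (tz : zeros n ≡ n₀) where

    ones-total : ones n ≡ n₁
    ones-total = +-cancelˡ-≡ n₀ (ones n) n₁ (trans (cong (_+ ones n) (sym tz)) (zeros+ones n))

    seen-total : ∀ c → seen c n ≡ occ false c n₀ + occ true c n₁
    seen-total c = trans (seen≡ c n) (cong₂ (λ a b → occ false c a + occ true c b) tz ones-total)

    FinitS : ∀ c → Finit (suc c) ≡ Finit c + seen c n
    FinitS c = begin
      Finit (suc c)
        ≡⟨ Finit≡ (suc c) ⟩
      suc (occLess false (suc c) n₀ + occLess true (suc c) n₁)
        ≡⟨ cong suc (cong₂ _+_ (occLess-suc false c n₀) (occLess-suc true c n₁)) ⟩
      suc ((occLess false c n₀ + occ false c n₀) + (occLess true c n₁ + occ true c n₁))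
        ≡⟨ cong suc (interchange (occLess false c n₀) (occ false c n₀) (occLess true c n₁) (occ true c n₁)) ⟩
      suc ((occLess false c n₀ + occLess true c n₁) + (occ false c n₀ + occ true c n₁))
        ≡⟨ cong₂ _+_ (sym (Finit≡ c)) (sym (seen-total c)) ⟩
      Finit c + seen c n ∎
      where open ≡-Reasoning

    Finit-mono : ∀ {a b} → a ≤ b → Finit a ≤ Finit b
    Finit-mono {a} le = interval-induction (λ k → Finit a ≤ Finit k) le ≤-refl
      (λ k _ _ ih → ≤-trans ih (subst (Finit k ≤_) (sym (FinitS k)) (m≤m+n _ _)))

    seen-sentinel : ∀ δ → seen (sentinel δ) n ≡ 1
    seen-sentinel false = trans (seen-total 0) (cong₂ _+_ (occ-own-sentinel false) (occ-other-sentinel true))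
    seen-sentinel true = trans (seen-total 1) (cong₂ _+_ (occ-other-sentinel false) (occ-own-sentinel true))

    Finit1 : Finit 1 ≡ 2
    Finit1 = trans (FinitS 0) (cong₂ _+_ Finit0 (seen-sentinel false))

    rank-range : ∀ k → 1 ≤ k → k ≤ n → 1 ≤ rank k × rank k ≤ len (z k)
    rank-range (suc k) _ q with z (suc k) in e
    ... | true = s≤s z≤n , subst₂ _≤_ (count-suc-hit z k e) ones-total (count-mono z q)
    ... | false = s≤s z≤n , subst₂ _≤_ (count-suc-hit (λ i → not (z i)) k (cong not e)) tz (count-mono (λ i → not (z i)) q)

    seen-before< : ∀ k → 1 ≤ k → k ≤ n → seen (letterRead k) (k ∸ 1) < seen (letterRead k) n
    seen-before< (suc k) _ q = ≤-trans (≤-reflexive (sym (seen-suc-hit (letterRead (suc k)) k refl))) (count-mono _ q)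

    pos : ℕ → ℕ
    pos k = Finit (letterRead k) + seen (letterRead k) (k ∸ 1)

    -- The special destinations 1, 2 of the sentinels agree with pos, since
    -- F_init[$₀] = 1, F_init[$₁] = 2 and each sentinel is read only once.
    dest≡pos : ∀ k → 1 ≤ k → k ≤ n → dest k ≡ pos k
    dest≡pos k a b with 1 <ᵇ letterRead k in e
    ... | true = refl
    ... | false = sentinel-dest (z k) refl
      where
      is-sentinel : letterRead k ≡ sentinel (z k)
      is-sentinel = bwt-small (z k) (rank k) (proj₁ (rank-range k a b)) (proj₂ (rank-range k a b)) (s≤s (<ᵇ-false⇒≥ e))
      first-read : seen (letterRead k) (k ∸ 1) ≡ 0
      first-read = n<1⇒n≡0 (subst (seen (letterRead k) (k ∸ 1) <_)
                     (trans (cong (λ c → seen c n) is-sentinel) (seen-sentinel (z k))) (seen-before< k a b))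
      sentinel-dest : ∀ b → z k ≡ b → (if z k then 2 else 1) ≡ pos k
      sentinel-dest true eb = trans (if-true eb)
        (sym (trans (cong₂ _+_ (cong Finit (trans is-sentinel (cong sentinel eb))) first-read) (cong (_+ 0) Finit1)))
      sentinel-dest false eb = trans (if-false eb)
        (sym (trans (cong₂ _+_ (cong Finit (trans is-sentinel (cong sentinel eb))) first-read) (cong (_+ 0) Finit0)))

    pos< : ∀ k → 1 ≤ k → k ≤ n → pos k < Finit (suc (letterRead k))
    pos< k a b = subst (pos k <_) (sym (FinitS (letterRead k))) (+-monoʳ-< (Finit (letterRead k)) (seen-before< k a b))

    seen-strict : ∀ c k k' → letterRead k ≡ c → 1 ≤ k → k < k' → seen c (k ∸ 1) < seen c (k' ∸ 1)
    seen-strict c (suc k) (suc k') e _ (s≤s lt) = ≤-trans (≤-reflexive (sym (seen-suc-hit c k e))) (count-mono _ lt)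

    -- Different steps write different positions: letters occupy disjoint
    -- ranges [F_init[c], F_init[c+1]), and within a range seen grows.
    pos-injective : ∀ k k' → 1 ≤ k → k ≤ n → 1 ≤ k' → k' ≤ n → pos k ≡ pos k' → k ≡ k'
    pos-injective k k' a b a' b' e with <-cmp (letterRead k) (letterRead k')
    ... | tri< lt _ _ = ⊥-elim (<⇒≢ (≤-trans (pos< k a b) (≤-trans (Finit-mono lt) (m≤m+n _ _))) e)
    ... | tri> _ _ gt = ⊥-elim (<⇒≢ (≤-trans (pos< k' a' b') (≤-trans (Finit-mono gt) (m≤m+n _ _))) (sym e))
    ... | tri≈ _ eq _ with <-cmp k k'
    ... | tri≈ _ x _ = x
    ... | tri< lt _ _ = ⊥-elim (<⇒≢ (seen-strict (letterRead k) k k' refl a lt)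
            (+-cancelˡ-≡ (Finit (letterRead k)) _ _ (trans e (cong (λ c → Finit c + seen c (k' ∸ 1)) (sym eq)))))
    ... | tri> _ _ gt = ⊥-elim (<⇒≢ (seen-strict (letterRead k') k' k refl a' gt)
            (+-cancelˡ-≡ (Finit (letterRead k')) _ _ (trans (sym e) (cong (λ c → Finit c + seen c (k ∸ 1)) eq))))

    jAt≡pos : ∀ K → K < n → jAt K ≡ pos (suc K)
    jAt≡pos K lt = trans (cong target (readc≡ K)) (trans (by-letter (1 <ᵇ letterRead (suc K)) refl) (dest≡pos (suc K) (s≤s z≤n) lt))
      where
      target : ℕ → ℕ
      target c = if 1 <ᵇ c then IState.F (state K) c else (if z (suc K) then 2 else 1)
      by-letter : ∀ b → (1 <ᵇ letterRead (suc K)) ≡ b → target (letterRead (suc K)) ≡ dest (suc K)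
      by-letter true e = trans (if-true e) (trans (F≡ K (letterRead (suc K)) e) (sym (if-true e)))
      by-letter false e = trans (if-false e) (sym (if-false e))

    Zpartial : ℕ → ℕ → Bool
    Zpartial K = IState.Znew (state K)

    Zpartial-pos : ∀ K → K ≤ n → ∀ k → 1 ≤ k → k ≤ K → Zpartial K (pos k) ≡ z k
    Zpartial-pos zero le k a b = ⊥-elim (<⇒≱ a b)
    Zpartial-pos (suc K) le k a b with m≤n⇒m<n∨m≡n b
    ... | inj₂ refl = trans (cong (λ j → if pos (suc K) ≡ᵇ j then z (suc K) else Zpartial K (pos (suc K))) (jAt≡pos K le))
                           (if-true (≡ᵇ-refl (pos (suc K))))
    ... | inj₁ (s≤s b') = trans (cong (λ j → if pos k ≡ᵇ j then z (suc K) else Zpartial K (pos k)) (jAt≡pos K le))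
                           (trans (if-false (≢⇒≡ᵇ-false ne)) (Zpartial-pos K (<⇒≤ le) k a b'))
      where
      ne : pos k ≢ pos (suc K)
      ne e = <⇒≢ (s≤s b') (pos-injective k (suc K) a (≤-trans b' (<⇒≤ le)) (s≤s z≤n) le e)

    -- A fresh step writes at F_init[c] + seen_c(q) where q + 1 is the old
    -- mark starting its block (or q = 0): no step of the block before it
    -- read c.
    fresh-dest : ∀ k → k < n → freshAt k ≡ true →
      ∃[ q ] (q ≤ n × (q ≡ 0 ⊎ B0 (suc q) ≢ 0) × jAt k ≡ Finit (letterRead (suc k)) + seen (letterRead (suc k)) q)
    fresh-dest k lt ef = q , ≤-trans q≤k (<⇒≤ lt) , boundary (blockId (suc k)) refl , trans (jAt≡pos k lt) (cong (Finit c +_) no-read)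
      where
      c q : ℕ
      c = letterRead (suc k)
      q = blockId (suc k) ∸ 1
      id≤ : blockId (suc k) ≤ suc q
      id≤ = m≤n+m∸n (blockId (suc k)) 1
      q≤k : q ≤ k
      q≤k = ∸-monoˡ-≤ 1 (blockId≤ (suc k))
      boundary : ∀ y → blockId (suc k) ≡ y → q ≡ 0 ⊎ B0 (suc q) ≢ 0
      boundary zero e = inj₁ (cong (_∸ 1) e)
      boundary (suc y) e = inj₂ (subst (λ x → B0 x ≢ 0) (cong (λ w → suc (w ∸ 1)) (sym e))
                       (oldMark⇒mark (suc y) (subst (λ x → oldMark x ≡ true) e (blockId-oldMark (suc k) (subst (1 ≤_) (sym e) (s≤s z≤n))))))
      no-read : seen c k ≡ seen c q
      no-read = count-flat (λ i → letterRead i ≡ᵇ c) q k q≤k no-hit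
        where
        no-hit : ∀ i → q < i → i ≤ k → (letterRead i ≡ᵇ c) ≡ false
        no-hit i x y with letterRead i ≡ᵇ c in e
        ... | false = refl
        ... | true = ⊥-elim (fresh⇒new k (trans (sym (freshAt≡ k)) ef) i (≤-trans (s≤s z≤n) x) y (≡ᵇ-true⇒≡ e)
                       (sym (blockId-flat i (suc k) (m≤n⇒m≤1+n y) same-block)))
          where
          same-block : ∀ r → i < r → r ≤ suc k → oldMark r ≡ false
          same-block r a b with oldMark r in eo
          ... | false = refl
          ... | true = ⊥-elim (<⇒≱ (≤-trans (s≤s x) a) (≤-trans (blockId≥ r (suc k) eo (≤-trans (s≤s z≤n) a) b) id≤))

    -- The LF property of the new vector Z^(p): the number of 0s before the
    -- destination F_init[c] + seen_c(q) equals the number of 0s of the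
    -- BWTs "smaller than" c in the merged order up to step q.
    module LF where

      Znext : ℕ → Bool
      Znext = Zpartial n

      zerosNext : ℕ → ℕ
      zerosNext = count (λ i → not (Znext i))

      -- Step q + 1 adds a 0 just before F_init[c] + seen_c(q + 1) exactly
      -- when it reads c from text 0: it writes at F_init[c] + seen_c(q).
      zerosNext-step : ∀ c q → suc q ≤ n →
        zerosNext (Finit c + seen c (suc q) ∸ 1)
          ≡ zerosNext (Finit c + seen c q ∸ 1) + bit (not (z (suc q)) ∧ (letterRead (suc q) ≡ᵇ c))
      zerosNext-step c q le = by-read (letterRead (suc q) ≡ᵇ c) refl
        where
        open ≡-Reasoning
        X δ : ℕ
        X = Finit c + seen c q ∸ 1
        δ = bit (not (z (suc q)) ∧ (letterRead (suc q) ≡ᵇ c))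
        written-here : letterRead (suc q) ≡ c → Znext (suc X) ≡ z (suc q)
        written-here rc = trans (cong Znext (sym pos≡)) (Zpartial-pos n ≤-refl (suc q) (s≤s z≤n) le)
          where
          pos≡ : pos (suc q) ≡ suc X
          pos≡ = trans (cong (λ d → Finit d + seen d q) rc)
                   (sym (trans (+-comm 1 X) (m∸n+n≡m {Finit c + seen c q} {1} (≤-trans (Finit≥1 c) (m≤m+n _ _)))))
        by-read : ∀ b → (letterRead (suc q) ≡ᵇ c) ≡ b → zerosNext (Finit c + seen c (suc q) ∸ 1) ≡ zerosNext X + δ
        by-read false ec = begin
          zerosNext (Finit c + seen c (suc q) ∸ 1)
            ≡⟨ cong (λ y → zerosNext (Finit c + y ∸ 1)) (seen-suc-miss c q (≡ᵇ-false⇒≢ ec)) ⟩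
          zerosNext X
            ≡⟨ sym (+-identityʳ _) ⟩
          zerosNext X + bit false
            ≡⟨ cong (λ t → zerosNext X + bit t) (sym (trans (cong (not (z (suc q)) ∧_) ec) (∧-zeroʳ _))) ⟩
          zerosNext X + δ ∎
        by-read true ec = begin
          zerosNext (Finit c + seen c (suc q) ∸ 1)
            ≡⟨ cong (λ y → zerosNext (Finit c + y ∸ 1)) (seen-suc-hit c q (≡ᵇ-true⇒≡ ec)) ⟩
          zerosNext (Finit c + suc (seen c q) ∸ 1)
            ≡⟨ cong (λ x → zerosNext (x ∸ 1)) (+-suc (Finit c) (seen c q)) ⟩
          zerosNext (suc X)
            ≡⟨ count-suc (λ i → not (Znext i)) X ⟩
          zerosNext X + bit (not (Znext (suc X)))
            ≡⟨ cong (λ b → zerosNext X + bit (not b)) (written-here (≡ᵇ-true⇒≡ ec)) ⟩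
          zerosNext X + bit (not (z (suc q)))
            ≡⟨ cong (λ t → zerosNext X + bit t) (sym (trans (cong (not (z (suc q)) ∧_) ec) (∧-identityʳ _))) ⟩
          zerosNext X + δ ∎

      zerosNext-Finit : ∀ c → zerosNext (Finit c ∸ 1) ≡ occLess false c n₀
      zerosNext-prefix : ∀ c q → q ≤ n → zerosNext (Finit c + seen c q ∸ 1) ≡ occLess false c n₀ + occ false c (zeros q)

      zerosNext-Finit zero = trans (cong (λ x → zerosNext (x ∸ 1)) Finit0) (sym (occLess-zero false n₀))
      zerosNext-Finit (suc c) = trans (cong (λ x → zerosNext (x ∸ 1)) (FinitS c))
        (trans (zerosNext-prefix c n ≤-refl) (trans (cong (λ r → occLess false c n₀ + occ false c r) tz) (sym (occLess-suc false c n₀))))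

      zerosNext-prefix c zero _ = trans (cong (λ x → zerosNext (x ∸ 1)) (+-identityʳ (Finit c)))
                                        (trans (zerosNext-Finit c) (sym (+-identityʳ _)))
      zerosNext-prefix c (suc q) le = begin
        zerosNext (Finit c + seen c (suc q) ∸ 1)
          ≡⟨ zerosNext-step c q le ⟩
        zerosNext (Finit c + seen c q ∸ 1) + δ
          ≡⟨ cong (_+ δ) (zerosNext-prefix c q (≤-trans (n≤1+n q) le)) ⟩
        occLess false c n₀ + occ false c (zeros q) + δ
          ≡⟨ +-assoc (occLess false c n₀) _ _ ⟩
        occLess false c n₀ + (occ false c (zeros q) + δ)
          ≡⟨ cong (occLess false c n₀ +_) (sym (occ-zeros-suc c q)) ⟩
        occLess false c n₀ + occ false c (zeros (suc q)) ∎
        where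
        open ≡-Reasoning
        δ : ℕ
        δ = bit (not (z (suc q)) ∧ (letterRead (suc q) ≡ᵇ c))

      zerosNext-total : zerosNext n ≡ n₀
      zerosNext-total = trans (cong (λ x → zerosNext (x ∸ 1)) (sym FinitTop))
                          (trans (zerosNext-Finit (2 + σ)) (occLess-top false n₀))

-- The iterations of the procedure: Pass h describes iteration h + 1.
module Iterations (σ : ℕ) (w₀ w₁ : List (Fin σ)) where
  open Text σ w₀ w₁
  open TextFacts σ w₀ w₁
  module PP (h : ℕ) = Pass σ w₀ w₁ (suc h) (Z h) (B h)
  module PB (h : ℕ) (tz : PP.zeros h n ≡ n₀) = PP.Balanced h tz

  -- Z^(0) = 0^n₀ 1^n₁ contains n₀ zeros, and by the LF property so does
  -- every Z^(h).
  zeros-initial : count (λ i → not (n₀ <ᵇ i)) n ≡ n₀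
  zeros-initial = trans (count-flat _ n₀ n (m≤m+n n₀ n₁) beyond)
    (trans (count-cong _ (λ _ → true) n₀ (λ i _ q → cong not (≥⇒<ᵇ-false q))) (count-always n₀))
    where
    beyond : ∀ i → n₀ < i → i ≤ n → not (n₀ <ᵇ i) ≡ false
    beyond i x _ = cong not (<⇒<ᵇ-true x)

  balanced : ∀ h → PP.zeros h n ≡ n₀
  balanced zero = zeros-initial
  balanced (suc h) = PB.LF.zerosNext-total h (balanced h)

  B0-marks : ∀ i → B 0 i ≢ 0 → i ≡ 1 ⊎ i ≡ suc n
  B0-marks i nz with i ≡ᵇ 1 in e1 | i ≡ᵇ suc n in e2
  ... | true | _ = inj₁ (≡ᵇ-true⇒≡ e1)
  ... | false | true = inj₂ (≡ᵇ-true⇒≡ e2)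
  ... | false | false = ⊥-elim (nz refl)

  B0≤1 : ∀ i → B 0 i ≤ 1
  B0≤1 i with (i ≡ᵇ 1) ∨ (i ≡ᵇ suc n)
  ... | true = ≤-refl
  ... | false = z≤n

  B0-end : B 0 (suc n) ≢ 0
  B0-end rewrite ≡ᵇ-refl n | ∨-zeroʳ (n ≡ᵇ 0) = λ ()

  mark-persists : ∀ {h g} i → h ≤ g → B h i ≢ 0 → B g i ≢ 0
  mark-persists i le nz = interval-induction (λ k → B k i ≢ 0) le nz (λ k _ _ ih → PP.mark-old k n i ih)

  mark-end : ∀ h → B h (suc n) ≢ 0
  mark-end h = mark-persists {g = h} (suc n) z≤n B0-end

  -- A mark set in iteration h + 1 has value h + 1, so it is not an old mark
  -- for iteration h + 2.
  mark≤iteration : ∀ h i → B (suc h) i ≤ suc h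
  mark≤iteration h i with PP.mark-value h n i
  ... | inj₂ e = ≤-reflexive e
  ... | inj₁ e = ≤-trans (≤-reflexive e) (earlier h)
    where
    earlier : ∀ h → B h i ≤ suc h
    earlier zero = B0≤1 i
    earlier (suc h) = m≤n⇒m≤1+n (mark≤iteration h i)

  Boundary : ℕ → ℕ → Set
  Boundary h q = q ≤ n × (q ≡ 0 ⊎ B h (suc q) ≢ 0)

  Boundary-mono : ∀ {h g} q → h ≤ g → Boundary h q → Boundary g q
  Boundary-mono q le (a , inj₁ e) = a , inj₁ e
  Boundary-mono q le (a , inj₂ e) = a , inj₂ (mark-persists (suc q) le e)

  seen-cong : ∀ h h' c q → PP.zeros h q ≡ PP.zeros h' q → PP.seen h c q ≡ PP.seen h' c q
  seen-cong h h' c q e = trans (PP.seen≡ h c q) (trans (cong₂ (λ a b → occ false c a + occ true c b) e same-ones)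
                           (sym (PP.seen≡ h' c q)))
    where
    same-ones : PP.ones h q ≡ PP.ones h' q
    same-ones = +-cancelˡ-≡ (PP.zeros h q) _ _
      (trans (PP.zeros+ones h q) (trans (sym (PP.zeros+ones h' q)) (cong (_+ PP.ones h' q) (sym e))))

  -- Every mark of iteration h + 1 lies at F_init[c] + seen_c(q) for a
  -- boundary q of iteration h; therefore the number of 0s up to a boundary
  -- is the same before and after the next iteration (LF property).
  mark-shape : ∀ h x → 1 ≤ x → x ≤ n → B (suc h) x ≢ 0 →
    ∃[ c ] ∃[ q ] (Boundary h q × x ≡ Finit c + PP.seen h c q)
  boundary-stable : ∀ h q → Boundary h q → PP.zeros (suc h) q ≡ PP.zeros h q

  mark-shape h x a b nz with PP.mark-origin h n x nz
  ... | inj₂ (k , kl , fr , jx) =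
    let (q , ql , bq , je) = PB.fresh-dest h (balanced h) k kl fr
    in PP.letterRead h (suc k) , q , (ql , bq) , trans (sym jx) je
  mark-shape zero x a b nz | inj₁ old with B0-marks x old
  ... | inj₁ refl = 0 , 0 , (z≤n , inj₁ refl) , sym (cong (_+ 0) (PP.Finit0 0))
  ... | inj₂ refl = ⊥-elim (<⇒≱ ≤-refl b)
  mark-shape (suc h) x a b nz | inj₁ old =
    let (c , q , bd , e) = mark-shape h x a b old
    in c , q , Boundary-mono q (n≤1+n h) bd , trans e (cong (Finit c +_) (sym (seen-cong (suc h) h c q (boundary-stable h q bd))))

  boundary-stable h zero _ = refl
  boundary-stable h (suc q) (le , inj₂ nz) with suc q ≟ n
  ... | yes e = trans (cong (PP.zeros (suc h)) e) (trans (balanced (suc h)) (trans (sym (balanced h)) (cong (PP.zeros h) (sym e))))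
  boundary-stable zero (suc q) (le , inj₂ nz) | no ne with B0-marks (suc (suc q)) nz
  ... | inj₂ e = ⊥-elim (ne (suc-injective e))
  boundary-stable (suc h) (suc q) (le , inj₂ nz) | no ne
    with mark-shape h (suc (suc q)) (s≤s z≤n) (≤∧≢⇒< le ne) nz
  ... | (c , q0 , bd0 , ex) = begin
    PP.zeros (suc (suc h)) (suc q)
      ≡⟨ cong (PP.zeros (suc (suc h))) (trans at (cong (λ y → Finit c + y ∸ 1) (sym stable-seen))) ⟩
    PP.zeros (suc (suc h)) (Finit c + PP.seen (suc h) c q0 ∸ 1)
      ≡⟨ PB.LF.zerosNext-prefix (suc h) (balanced (suc h)) c q0 (proj₁ bd0) ⟩
    occLess false c n₀ + occ false c (PP.zeros (suc h) q0)
      ≡⟨ cong (λ r → occLess false c n₀ + occ false c r) (boundary-stable h q0 bd0) ⟩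
    occLess false c n₀ + occ false c (PP.zeros h q0)
      ≡⟨ sym (PB.LF.zerosNext-prefix h (balanced h) c q0 (proj₁ bd0)) ⟩
    PP.zeros (suc h) (Finit c + PP.seen h c q0 ∸ 1)
      ≡⟨ cong (PP.zeros (suc h)) (sym at) ⟩
    PP.zeros (suc h) (suc q) ∎
    where
    open ≡-Reasoning
    at : suc q ≡ Finit c + PP.seen h c q0 ∸ 1
    at = cong (_∸ 1) ex
    stable-seen : PP.seen (suc h) c q0 ≡ PP.seen h c q0
    stable-seen = seen-cong (suc h) h c q0 (boundary-stable h q0 bd0)

  zeros-stable : ∀ {h g} q → h ≤ g → Boundary h q → PP.zeros g q ≡ PP.zeros h q
  zeros-stable {h} q le bd = interval-induction (λ k → PP.zeros k q ≡ PP.zeros h q) le refl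
    (λ k x _ ih → trans (boundary-stable k q (Boundary-mono q x bd)) ih)

  ones-stable : ∀ {h g} q → h ≤ g → Boundary h q → PP.ones g q ≡ PP.ones h q
  ones-stable {h} {g} q le bd = +-cancelˡ-≡ (PP.zeros h q) _ _
    (trans (cong (_+ PP.ones g q) (sym (zeros-stable q le bd))) (trans (PP.zeros+ones g q) (sym (PP.zeros+ones h q))))

  -- Entries of Z^(h) differing from v are counted by zeros (v = 1) or ones
  -- (v = 0); their number up to a boundary never changes.
  mismatches : Bool → ℕ → ℕ → ℕ
  mismatches v h = count (λ i → v xor Z h i)

  mismatches-stable : ∀ v {h g} q → h ≤ g → Boundary h q → mismatches v g q ≡ mismatches v h q
  mismatches-stable true = zeros-stable
  mismatches-stable false = ones-stable

  xor-self : ∀ v → v xor v ≡ false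
  xor-self true = refl
  xor-self false = refl

  xor-false : ∀ v b → v xor b ≡ false → b ≡ v
  xor-false true true _ = refl
  xor-false false false _ = refl

  -- Part (i): a monochrome block has no mismatch, and its two ends are
  -- boundaries, so it has no mismatch in any later iteration either.
  part-i : ∀ h ℓ m → IsBlock h ℓ m → Monochrome h ℓ m →
    (g : ℕ) → h < g → (i : ℕ) → ℓ ≤ i → i ≤ m → Z g i ≡ Z h i
  part-i h ℓ m (ℓ≥1 , ℓ≤m , m≤n , mark-ℓ , mark-m+1 , _) (v , mono) g hg i a b =
    trans (xor-false v (Z g i) (count-flat⇒misses (λ x → v xor Z g x) (ℓ ∸ 1) m no-new i before-i b)) (sym (mono i a b))
    where
    start : Boundary h (ℓ ∸ 1)
    start = ≤-trans (m∸n≤m ℓ 1) (≤-trans ℓ≤m m≤n) , inj₂ (subst (λ y → B h y ≢ 0) (sym (suc-∸1 ℓ ℓ≥1)) mark-ℓ)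
    end : Boundary h m
    end = m≤n , inj₂ mark-m+1
    before-i : ℓ ∸ 1 < i
    before-i = ≤-trans (≤-reflexive (suc-∸1 ℓ ℓ≥1)) a
    no-mismatch : ∀ x → ℓ ∸ 1 < x → x ≤ m → v xor Z h x ≡ false
    no-mismatch x p q = trans (cong (v xor_) (mono x (≤-trans (≤-reflexive (sym (suc-∸1 ℓ ℓ≥1))) p) q)) (xor-self v)
    no-new : mismatches v g m ≡ mismatches v g (ℓ ∸ 1)
    no-new = begin
      mismatches v g m            ≡⟨ mismatches-stable v m (<⇒≤ hg) end ⟩
      mismatches v h m            ≡⟨ count-flat _ (ℓ ∸ 1) m (≤-trans (m∸n≤m ℓ 1) ℓ≤m) no-mismatch ⟩
      mismatches v h (ℓ ∸ 1)      ≡⟨ sym (mismatches-stable v (ℓ ∸ 1) (<⇒≤ hg) start) ⟩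
      mismatches v g (ℓ ∸ 1)      ∎
      where open ≡-Reasoning

  enclosing-block : ∀ g a b j → 1 ≤ a → a ≤ j → j < b → b ≤ suc n → B g a ≢ 0 → B g b ≢ 0 →
    ∃[ l ] ∃[ r ] (IsBlock g l r × a ≤ l × l ≤ j × j ≤ r × r < b)
  enclosing-block g a b j a1 aj jb bn ma mb with lastNonzero (B g) a j aj ma | firstNonzero (B g) j b jb mb
  ... | (l , al , lj , ml , zl) | (zero , () , _)
  ... | (l , al , lj , ml , zl) | (suc r , jr , rb , mr , zr) =
    l , r , (≤-trans a1 al , ≤-trans lj (≤-pred jr) , ≤-pred (≤-trans rb bn) , ml , mr , inside) , al , lj , ≤-pred jr , rb
    where
    inside : ∀ i → l < i → i ≤ r → B g i ≡ 0
    inside i x y with i ≤? j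
    ... | yes q = zl i x q
    ... | no q = zr i (≰⇒> q) (s≤s y)

  -- Part (ii), for a monochrome block [ℓ, m] of colour v at the end of
  -- iteration h = h' + 1, looking at iteration h + 1.
  module PartII (h' ℓ m : ℕ) (blk : IsBlock (suc h') ℓ m) (mono : Monochrome (suc h') ℓ m) where
    h : ℕ
    h = suc h'
    open Pass σ w₀ w₁ (suc h) (Z h) (B h)
    open Balanced (balanced h)

    ℓ≥1 : 1 ≤ ℓ
    ℓ≥1 = proj₁ blk
    ℓ≤m : ℓ ≤ m
    ℓ≤m = proj₁ (proj₂ blk)
    m≤n : m ≤ n
    m≤n = proj₁ (proj₂ (proj₂ blk))
    mark-ℓ : B h ℓ ≢ 0
    mark-ℓ = proj₁ (proj₂ (proj₂ (proj₂ blk)))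
    mark-m+1 : B h (suc m) ≢ 0
    mark-m+1 = proj₁ (proj₂ (proj₂ (proj₂ (proj₂ blk))))
    v : Bool
    v = proj₁ mono

    lo : ℕ
    lo = ℓ ∸ 1

    lo<ℓ : lo < ℓ
    lo<ℓ = ≤-reflexive (suc-∸1 ℓ ℓ≥1)

    lo≤m : lo ≤ m
    lo≤m = ≤-trans (m∸n≤m ℓ 1) ℓ≤m

    mark⇒oldMark : ∀ x → B h x ≢ 0 → oldMark x ≡ true
    mark⇒oldMark x nz rewrite ≢⇒≡ᵇ-false nz
      | ≢⇒≡ᵇ-false {B h x} {suc h} (λ e → <⇒≱ (s≤s ≤-refl) (subst (_≤ h) e (mark≤iteration h' x))) = refl

    fresh-intro : ∀ k d q → letterRead (suc k) ≡ d → seen d k ≡ seen d q →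
      (∀ k'' → 1 ≤ k'' → k'' ≤ q → blockId k'' < blockId (suc k)) → freshAt k ≡ true
    fresh-intro k d q rd no-read earlier = trans (freshAt≡ k) (new⇒fresh k other-block)
      where
      other-block : ∀ k'' → 1 ≤ k'' → k'' ≤ k → letterRead k'' ≡ letterRead (suc k) → blockId k'' ≢ blockId (suc k)
      other-block k'' a b s with k'' ≤? q
      ... | yes x = <⇒≢ (earlier k'' a x)
      ... | no x = ⊥-elim (true≢false (trans (sym (subst (λ y → (y ≡ᵇ d) ≡ true) (sym (trans s rd)) (≡ᵇ-refl d)))
                     (count-flat⇒misses (λ i → letterRead i ≡ᵇ d) q k no-read k'' (≰⇒> x) b)))

    -- The first read of d after a boundary q of iteration h is fresh, so the
    -- position F_init[d] + seen_d(q) is marked in iteration h + 1.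
    first-read-marked : ∀ d q → q ≤ n → (q ≡ 0 ⊎ B h (suc q) ≢ 0) → seen d q < seen d n →
      B (suc h) (Finit d + seen d q) ≢ 0
    first-read-marked d q qn bd more with count-crossing (λ i → letterRead i ≡ᵇ d) q n (seen d q) qn ≤-refl more
    ... | (zero , () , _)
    ... | (suc k , qk , kn , before , rd) =
      subst (λ x → B (suc h) x ≢ 0) writes (mark-fresh k n kn (λ ()) fresh)
      where
      earlier : ∀ k'' → 1 ≤ k'' → k'' ≤ q → blockId k'' < blockId (suc k)
      earlier k'' a b = by-boundary bd
        where
        by-boundary : (q ≡ 0 ⊎ B h (suc q) ≢ 0) → blockId k'' < blockId (suc k)
        by-boundary (inj₁ refl) = ⊥-elim (<⇒≱ a b)
        by-boundary (inj₂ mark) = ≤-trans (s≤s (≤-trans (blockId≤ k'') b))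
                                    (blockId≥ (suc q) (suc k) (mark⇒oldMark (suc q) mark) (s≤s z≤n) qk)
      fresh : freshAt k ≡ true
      fresh = fresh-intro k d q (≡ᵇ-true⇒≡ rd) before earlier
      writes : jAt k ≡ Finit d + seen d q
      writes = trans (jAt≡pos k kn) (trans (cong (λ e → Finit e + seen e k) (≡ᵇ-true⇒≡ rd)) (cong (Finit d +_) before))

    nextLetter : ∀ u d → 2 + σ ≤ u + d → Finit d ≤ n → ∃[ d' ] (Finit d' ≡ Finit d × 0 < seen d' n)
    nextLetter zero d le fn = ⊥-elim (<⇒≱ (≤-trans (≤-reflexive (sym FinitTop)) (Finit-mono le)) fn)
    nextLetter (suc u) d le fn with seen d n ≟ 0
    ... | no nz = d , refl , n≢0⇒n>0 nz
    ... | yes z0 = let (d' , e , p) = nextLetter u (suc d) (subst (2 + σ ≤_) (sym (+-suc u d)) le)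
                                        (subst (_≤ n) (sym unread) fn)
                   in d' , trans e unread , p
      where
      unread : Finit (suc d) ≡ Finit d
      unread = trans (FinitS d) (trans (cong (Finit d +_) z0) (+-identityʳ _))

    -- The steps of the block that read c write exactly the interval
    -- [range-start c, range-end c), and both ends are marked.
    range-start range-end : ℕ → ℕ
    range-start c = Finit c + seen c lo
    range-end c = Finit c + seen c m

    range-end≤ : ∀ c → range-end c ≤ suc n
    range-end≤ c = ≤-trans (+-monoʳ-≤ (Finit c) (count-mono _ m≤n))
                     (≤-trans (≤-reflexive (sym (FinitS c))) (Finit≤ (suc c)))

    range-filled : ∀ c i → range-start c ≤ i → i < range-end c → ∃[ k ] (ℓ ≤ k × k ≤ m × pos k ≡ i)
    range-filled c i x y with count-crossing (λ i → letterRead i ≡ᵇ c) lo m (i ∸ Finit c) lo≤m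
                                (≤-trans (≤-reflexive (sym (m+n∸m≡n (Finit c) (seen c lo)))) (∸-monoˡ-≤ (Finit c) x))
                                (≤-trans (≤-reflexive (sym (+-∸-assoc 1 Finit≤i)))
                                  (≤-trans (∸-monoˡ-≤ (Finit c) y) (≤-reflexive (m+n∸m≡n (Finit c) (seen c m)))))
      where
      Finit≤i : Finit c ≤ i
      Finit≤i = ≤-trans (m≤m+n (Finit c) (seen c lo)) x
    ... | (k , p , q , e , s) = k , ≤-trans (≤-reflexive (sym (suc-∸1 ℓ ℓ≥1))) p , q ,
            trans (cong (λ d → Finit d + seen d (k ∸ 1)) (≡ᵇ-true⇒≡ s))
                  (trans (cong (Finit c +_) e) (m+[n∸m]≡n (≤-trans (m≤m+n (Finit c) (seen c lo)) x)))

    range-start-marked : ∀ c → seen c lo < seen c m → B (suc h) (range-start c) ≢ 0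
    range-start-marked c more = first-read-marked c lo (≤-trans lo≤m m≤n)
      (inj₂ (subst (λ y → B h y ≢ 0) (sym (suc-∸1 ℓ ℓ≥1)) mark-ℓ)) (≤-trans more (count-mono _ m≤n))

    range-end-marked : ∀ c → B (suc h) (range-end c) ≢ 0
    range-end-marked c with seen c m <? seen c n
    ... | yes more = first-read-marked c m m≤n (inj₂ mark-m+1) more
    ... | no none-after with range-end c ≟ suc n
    ... | yes e = subst (λ x → B (suc h) x ≢ 0) (sym e) (mark-end (suc h))
    ... | no ne = next (nextLetter (2 + σ) (suc c) (m≤m+n (2 + σ) (suc c)) Finit≤n)
      where
      at-next : range-end c ≡ Finit (suc c)
      at-next = trans (cong (Finit c +_) (≤-antisym (count-mono _ m≤n) (≮⇒≥ none-after))) (sym (FinitS c))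
      Finit≤n : Finit (suc c) ≤ n
      Finit≤n = ≤-pred (≤∧≢⇒< (subst (_≤ suc n) at-next (range-end≤ c)) (λ x → ne (trans at-next x)))
      next : ∃[ d ] (Finit d ≡ Finit (suc c) × 0 < seen d n) → B (suc h) (range-end c) ≢ 0
      next (d , e , read) = subst (λ x → B (suc h) x ≢ 0) (trans (+-identityʳ (Finit d)) (trans e (sym at-next)))
                              (first-read-marked d 0 z≤n (inj₁ refl) read)

    block-written : ∀ i → ∃[ k ] (ℓ ≤ k × k ≤ m × pos k ≡ i) → WrittenIn (suc h) ℓ m i
    block-written i (zero , p , q , e) = ⊥-elim (<⇒≱ (≤-trans ℓ≥1 p) z≤n)
    block-written i (suc k , p , q , e) = suc k , p , q , trans (jAt≡pos k (≤-trans q m≤n)) e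

    block-colour : ∀ i → ∃[ k ] (ℓ ≤ k × k ≤ m × pos k ≡ i) → Z (suc h) i ≡ v
    block-colour i (k , p , q , e) = trans (cong (Z (suc h)) (sym e))
      (trans (Zpartial-pos n ≤-refl k (≤-trans ℓ≥1 p) (≤-trans q m≤n)) (proj₂ mono k p q))

    part-ii : (j : ℕ) → WrittenIn (suc h) ℓ m j →
      ∃[ ℓ′ ] ∃[ m′ ] (IsBlock (suc h) ℓ′ m′ × Monochrome (suc h) ℓ′ m′
        × ℓ′ ≤ j × j ≤ m′ × ((i : ℕ) → ℓ′ ≤ i → i ≤ m′ → WrittenIn (suc h) ℓ m i))
    part-ii j (zero , lk , km , w) = ⊥-elim (<⇒≱ (≤-trans ℓ≥1 lk) z≤n)
    part-ii j (suc k , lk , km , w)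
      with enclosing-block (suc h) (range-start c) (range-end c) j start≥1 start≤j j<end (range-end≤ c)
             (range-start-marked c read-in-block) (range-end-marked c)
      where
      c : ℕ
      c = letterRead (suc k)
      j≡ : j ≡ Finit c + seen c k
      j≡ = trans (sym w) (jAt≡pos k (≤-trans km m≤n))
      read-in-block : seen c lo < seen c m
      read-in-block = ≤-trans (s≤s (count-mono _ (≤-pred (≤-trans lo<ℓ lk))))
                        (≤-trans (≤-reflexive (sym (seen-suc-hit c k refl))) (count-mono _ km))
      start≥1 : 1 ≤ range-start c
      start≥1 = ≤-trans (Finit≥1 c) (m≤m+n _ _)
      start≤j : range-start c ≤ j
      start≤j = subst (range-start c ≤_) (sym j≡) (+-monoʳ-≤ (Finit c) (count-mono _ (≤-pred (≤-trans lo<ℓ lk))))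
      j<end : j < range-end c
      j<end = subst (_< range-end c) (sym j≡)
                (+-monoʳ-< (Finit c) (≤-trans (≤-reflexive (sym (seen-suc-hit c k refl))) (count-mono _ km)))
    ... | (l , r , isBlock , sl , lj , jr , re) = l , r , isBlock , (v , λ i x y → block-colour i (filled i x y)) , lj , jr ,
          λ i x y → block-written i (filled i x y)
      where
      filled : ∀ i → l ≤ i → i ≤ r → ∃[ k ] (ℓ ≤ k × k ≤ m × pos k ≡ i)
      filled i x y = range-filled (letterRead (suc k)) i (≤-trans sl x) (≤-trans (s≤s y) re)


lemma5 : (σ : ℕ) (w₀ w₁ : List (Fin σ)) (h ℓ m : ℕ) → 1 ≤ h →
    let open Text σ w₀ w₁ in
    IsBlock h ℓ m → Monochrome h ℓ m →
    ((g : ℕ) → h < g → (i : ℕ) → ℓ ≤ i → i ≤ m → Z g i ≡ Z h i)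
    × ((j : ℕ) → WrittenIn (suc h) ℓ m j →
    ∃[ ℓ′ ] ∃[ m′ ] (IsBlock (suc h) ℓ′ m′ × Monochrome (suc h) ℓ′ m′
    × ℓ′ ≤ j × j ≤ m′ × ((i : ℕ) → ℓ′ ≤ i → i ≤ m′ → WrittenIn (suc h) ℓ m i)))
lemma5 σ w₀ w₁ (suc h′) ℓ m _ blk mono =
  part-i (suc h′) ℓ m blk mono , PartII.part-ii h′ ℓ m blk mono
  where open Iterations σ w₀ w₁
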